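{- For every integer $v\ge 3$ there is a partial geometric design with parameters $(2v,\binom{v}{2},4,v-1;4,2v)$ whose points can be ordered so that its concurrence matrix is the $2v\times 2v$ circulant matrix whose first row is $[v-1,\underbrace{1,\dots,1}_{v-1},v-1,\underbrace{1,\dots,1}_{v-1}]$. The spectrum of this concurrence matrix is $[4(v-1)^{1},(2v-4)^{v-1},0^{v}]$ (eigenvalue with multiplicity as exponent).
   Context: A tactical configuration with parameters $(v,b,k,r)$ is a finite incidence structure with $v$ points and $b$ blocks (repeated blocks allowed), each block incident with exactly $k$ points and each point with exactly $r$ blocks. A partial geometric design (PGD) with parameters $(v,b,k,r;\alpha,\beta)$ is a tactical configuration with parameters $(v,b,k,r)$ whose $v\times b$ incidence matrix $N$ satisfies $NN^TN=\beta N+\alpha(J-N)$, $J$ the all-ones matrix; equivalently, for each point $a$ and block $B$ the number of flags $(x,A)$ with $x\in A\cap B$ and $a\in A$ is $\alpha$ if $a\notin B$ and $\beta$ if $a\in B$. The concurrence matrix is $NN^T$ (rows/columns indexed by points in a chosen order); its $(x,y)$ entry is the number of blocks containing both $x$ and $y$. A $v\times v$ matrix is circulant if its $(i,j)$ entry depends only on $j-i \bmod v$. -}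

module Defs where

open import Data.Nat using (ℕ; zero; suc; _+_; _*_; _∸_; _≤ᵇ_; _≡ᵇ_)
open import Data.Integer as ℤ using (ℤ; +_)
open import Data.Bool using (Bool; true; false; if_then_else_; _∨_)
open import Data.Fin using (Fin; toℕ; punchIn)
import Data.Fin as F
open import Data.Product using (_×_)
open import Relation.Binary.PropositionalEquality using (_≡_)
open import Relation.Nullary.Decidable using (⌊_⌋)

sumℕ : ∀ {n} → (Fin n → ℕ) → ℕ
sumℕ {zero}  f = 0
sumℕ {suc n} f = f F.zero + sumℕ (λ i → f (F.suc i))

sumℤ : ∀ {n} → (Fin n → ℤ) → ℤ
sumℤ {zero}  f = + 0
sumℤ {suc n} f = f F.zero ℤ.+ sumℤ (λ i → f (F.suc i))

⟦_⟧ : Bool → ℕ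
⟦ true ⟧  = 1
⟦ false ⟧ = 0

-- incidence matrix of an incidence structure with v points and b blocks
-- (repeated blocks allowed: blocks are just indices)
Incidence : ℕ → ℕ → Set
Incidence v b = Fin v → Fin b → Bool

IsTactical : ∀ {v b} → Incidence v b → ℕ → ℕ → Set
IsTactical N k r =
  (∀ B → sumℕ (λ x → ⟦ N x B ⟧) ≡ k) × (∀ x → sumℕ (λ B → ⟦ N x B ⟧) ≡ r)

NNᵀN : ∀ {v b} → Incidence v b → Fin v → Fin b → ℕ
NNᵀN N a B = sumℕ (λ A → sumℕ (λ x → ⟦ N a A ⟧ * ⟦ N x A ⟧ * ⟦ N x B ⟧))

-- partial geometric design with parameters (v,b,k,r;α,β):
-- N Nᵀ N = β N + α (J − N), entrywise
IsPGD : ∀ {v b} → Incidence v b → (k r α β : ℕ) → Set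
IsPGD N k r α β =
  IsTactical N k r ×
  (∀ a B → NNᵀN N a B ≡ β * ⟦ N a B ⟧ + α * (1 ∸ ⟦ N a B ⟧))

concurrence : ∀ {v b} → Incidence v b → Fin v → Fin v → ℕ
concurrence N x y = sumℕ (λ A → ⟦ N x A ⟧ * ⟦ N y A ⟧)

diffMod : ∀ {n} → Fin n → Fin n → ℕ
diffMod {n} i j =
  if toℕ i ≤ᵇ toℕ j then toℕ j ∸ toℕ i else (n + toℕ j) ∸ toℕ i

circulant : (n : ℕ) → (ℕ → ℕ) → Fin n → Fin n → ℕ
circulant n row i j = row (diffMod i j)

firstRow : ℕ → ℕ → ℕ
firstRow v d = if (d ≡ᵇ 0) ∨ (d ≡ᵇ v) then v ∸ 1 else 1

det : ∀ n → (Fin n → Fin n → ℤ) → ℤ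
det zero    M = + 1
det (suc n) M = sumℤ (λ j →
  (ℤ.- (+ 1)) ℤ.^ toℕ j ℤ.* M F.zero j ℤ.* det n (λ i k → M (F.suc i) (punchIn j k)))

charMat : ∀ {n} → ℤ → (Fin n → Fin n → ℕ) → Fin n → Fin n → ℤ
charMat x M i j = (if ⌊ i F.≟ j ⌋ then x else + 0) ℤ.- + M i j

charPoly : ∀ n → (Fin n → Fin n → ℕ) → ℤ → ℤ
charPoly n M x = det n (charMat x M)

-- Take the complete graph on v vertices and double every vertex: the points are
-- 0 , … , 2v − 1, and the edge {a , b} gives the block of the four points whose
-- residue modulo v is a or b. Two points then share v − 1 blocks if they have the
-- same residue and one block otherwise, which is the circulant concurrence matrix,
-- and summing these numbers over the four points of a block gives 2v or 4
-- according as the block contains the given point or not.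
--
-- For the spectrum, det (x I − C) is computed by row operations: subtracting the
-- top rows from the bottom ones and then clearing the top-right block leaves x ^ v
-- times the v × v determinant det ((x − 2v + 4) I − 2 J), and that one equals
-- (x − 2v + 4) ^ (v − 1) (x − 4v + 4).

module Submission where

open import Defs
open import Data.Nat.Base using (ℕ)
open import Data.Integer.Base using (ℤ)
open import Algebra.Bundles using (Semiring)

module SemiringSums {c ℓ} (R : Semiring c ℓ) where
  open import Data.Nat.Base using (ℕ; suc; _<_)
  open import Data.Fin.Base using (Fin; toℕ; punchIn; fromℕ<)
  open import Data.Fin.Properties using (punchInᵢ≢i; toℕ-fromℕ<; toℕ-injective; toℕ<n)
  open import Function using (_∘_)
  open import Relation.Binary.PropositionalEquality as ≡ using (_≢_)
  open Semiring R
  open import Algebra.Properties.Semiring.Sum R using (sum; sum-cong-≋; sum-replicate-zero; sum-remove)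
  open import Relation.Binary.Reasoning.Setoid setoid

  ∑-zero : ∀ {n} {f : Fin n → Carrier} → (∀ i → f i ≈ 0#) → sum f ≈ 0#
  ∑-zero {n} f≈0 = trans (sum-cong-≋ f≈0) (sum-replicate-zero n)

  ∑-single : ∀ {n} (g : ℕ → Carrier) P → P < n → (∀ Q → Q < n → Q ≢ P → g Q ≈ 0#) → sum {n} (g ∘ toℕ) ≈ g P
  ∑-single {suc n} g P P<n others = begin
    sum {suc n} (g ∘ toℕ)                 ≈⟨ sum-remove {i = i} (g ∘ toℕ) ⟩
    g (toℕ i) + sum {n} (g ∘ toℕ ∘ punchIn i) ≈⟨ +-cong (reflexive (≡.cong g toℕ-i)) (∑-zero λ k → others _ (toℕ<n _) (punchedOut k)) ⟩
    g P + 0#                              ≈⟨ +-identityʳ (g P) ⟩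
    g P ∎
    where
    i = fromℕ< P<n
    toℕ-i = toℕ-fromℕ< P<n
    punchedOut : ∀ k → toℕ (punchIn i k) ≢ P
    punchedOut k eq = punchInᵢ≢i i k (toℕ-injective (≡.trans eq (≡.sym toℕ-i)))

module Comparisons where
  open import Data.Nat
  open import Data.Nat.Properties using (≡ᵇ⇒≡)
  open import Data.Bool using (true; false; T)
  open import Data.Unit using (tt)
  open import Data.Empty using (⊥-elim)
  open import Function using (_∘_)
  open import Relation.Binary.PropositionalEquality

  ≡ᵇ-refl : ∀ m → (m ≡ᵇ m) ≡ true
  ≡ᵇ-refl zero    = refl
  ≡ᵇ-refl (suc m) = ≡ᵇ-refl m

  ≢⇒≡ᵇ≡false : ∀ {m n} → m ≢ n → (m ≡ᵇ n) ≡ false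
  ≢⇒≡ᵇ≡false {m} {n} m≢n with m ≡ᵇ n in eq
  ... | true  = ⊥-elim (m≢n (≡ᵇ⇒≡ m n (subst T (sym eq) tt)))
  ... | false = refl

  ≡ᵇ≡false⇒≢ : ∀ {m n} → (m ≡ᵇ n) ≡ false → m ≢ n
  ≡ᵇ≡false⇒≢ {m} eq refl with trans (sym (≡ᵇ-refl m)) eq
  ... | ()

  ≡ᵇ≡true⇒≡ : ∀ {m n} → (m ≡ᵇ n) ≡ true → m ≡ n
  ≡ᵇ≡true⇒≡ {m} {n} eq = ≡ᵇ⇒≡ m n (subst T (sym eq) tt)

  ≡ᵇ-cancelˡ : ∀ v K L → (v + K ≡ᵇ v + L) ≡ (K ≡ᵇ L)
  ≡ᵇ-cancelˡ zero    K L = refl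
  ≡ᵇ-cancelˡ (suc v) K L = ≡ᵇ-cancelˡ v K L

  <⇒<ᵇ≡true : ∀ {m n} → m < n → (m <ᵇ n) ≡ true
  <⇒<ᵇ≡true {zero}  {suc n} _         = refl
  <⇒<ᵇ≡true {suc m} {suc n} (s≤s m<n) = <⇒<ᵇ≡true m<n

  ≥⇒<ᵇ≡false : ∀ {m n} → n ≤ m → (m <ᵇ n) ≡ false
  ≥⇒<ᵇ≡false {m}     {zero}  _         = refl
  ≥⇒<ᵇ≡false {suc m} {suc n} (s≤s n≤m) = ≥⇒<ᵇ≡false n≤m

  ≡⇒≡ᵇ≡true : ∀ {m n} → m ≡ n → (m ≡ᵇ n) ≡ true
  ≡⇒≡ᵇ≡true {m} refl = ≡ᵇ-refl m

  ≡ᵇ-iff : ∀ {a b c d} → (a ≡ b → c ≡ d) → (c ≡ d → a ≡ b) → (a ≡ᵇ b) ≡ (c ≡ᵇ d)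
  ≡ᵇ-iff {a} {b} {c} {d} ⇒ ⇐ with a ≡ᵇ b in a≡ᵇb | c ≡ᵇ d in c≡ᵇd
  ... | true  | true  = refl
  ... | false | false = refl
  ... | true  | false = trans (sym (≡⇒≡ᵇ≡true (⇒ (≡ᵇ≡true⇒≡ a≡ᵇb)))) c≡ᵇd
  ... | false | true  = trans (sym a≡ᵇb) (≡⇒≡ᵇ≡true (⇐ (≡ᵇ≡true⇒≡ c≡ᵇd)))

  <ᵇ-suc : ∀ a t → a ≢ t → (a <ᵇ suc t) ≡ (a <ᵇ t)
  <ᵇ-suc zero    zero    a≢t = ⊥-elim (a≢t refl)
  <ᵇ-suc zero    (suc t) _   = refl
  <ᵇ-suc (suc a) zero    _   = refl
  <ᵇ-suc (suc a) (suc t) a≢t = <ᵇ-suc a t (a≢t ∘ cong suc)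

  <ᵇ-irrefl : ∀ t → (t <ᵇ t) ≡ false
  <ᵇ-irrefl zero    = refl
  <ᵇ-irrefl (suc t) = <ᵇ-irrefl t

  <ᵇ-suc-self : ∀ t → (t <ᵇ suc t) ≡ true
  <ᵇ-suc-self zero    = refl
  <ᵇ-suc-self (suc t) = <ᵇ-suc-self t

open Comparisons

-- The indices 0 , … , 2v − 1 split into the top half I < v and the bottom
-- half v + K, and both halves are indexed by the residue modulo v.
module Halves (v′ : ℕ) where
  open import Data.Nat
  open import Data.Nat.Properties
  open import Data.Bool using (Bool; true; false; if_then_else_)
  open import Relation.Binary.PropositionalEquality
  open import Relation.Nullary using (yes; no)

  v : ℕ
  v = suc v′

  -- abstract, so that rewriting by the lemmas below is not disturbed by unfolding
  abstract
    isTop : ℕ → Bool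
    isTop I = I <ᵇ v

    residue : ℕ → ℕ
    residue I = if isTop I then I else I ∸ v

    isTop-top : ∀ {I} → I < v → isTop I ≡ true
    isTop-top = <⇒<ᵇ≡true

    isTop-bottom : ∀ K → isTop (v + K) ≡ false
    isTop-bottom K = ≥⇒<ᵇ≡false (m≤m+n v K)

    isTop-suc : ∀ P → isTop (suc P) ≡ (P <ᵇ v′)
    isTop-suc P = refl

    isTop-≡ : ∀ I → isTop I ≡ (I <ᵇ v)
    isTop-≡ I = refl

    residue-top : ∀ {I} → I < v → residue I ≡ I
    residue-top I<v rewrite <⇒<ᵇ≡true I<v = refl

    residue-bottom : ∀ K → residue (v + K) ≡ K
    residue-bottom K rewrite ≥⇒<ᵇ≡false {v + K} {v} (m≤m+n v K) = m+n∸m≡n v K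

  data Half (I : ℕ) : Set where
    top    : I < v → Half I
    bottom : ∀ K → K < v → I ≡ v + K → Half I

  half : ∀ I → I < 2 * v → Half I
  half I I<2v with I <? v
  ... | yes I<v = top I<v
  ... | no  I≮v = bottom (I ∸ v) K<v (sym (m+[n∸m]≡n v≤I))
    where
    v≤I = ≮⇒≥ I≮v
    K<v : I ∸ v < v
    K<v = +-cancelˡ-< v (I ∸ v) v (subst (_< v + v) (sym (m+[n∸m]≡n v≤I)) (subst (I <_) (cong (v +_) (+-identityʳ v)) I<2v))

  residue<v : ∀ I → I < 2 * v → residue I < v
  residue<v I I<2v with half I I<2v
  ... | top I<v          rewrite residue-top I<v  = I<v
  ... | bottom K K<v refl rewrite residue-bottom K = K<v

  top≢bottom : ∀ {I} K → I < v → v + K ≢ I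
  top≢bottom {I} K I<v eq = <⇒≱ I<v (subst (v ≤_) eq (m≤m+n v K))

module CirculantPattern (v′ : ℕ) where
  open import Data.Nat
  open import Data.Nat.Properties
  open import Data.Bool using (Bool; true; false; if_then_else_; T; _∨_)
  open import Data.Bool.Properties using (∨-identityʳ)
  open import Data.Unit using (tt)
  open import Data.Fin using (Fin; toℕ)
  open import Data.Fin.Properties using (toℕ<n)
  open import Data.Empty using (⊥-elim)
  open import Relation.Binary.PropositionalEquality
  open Halves v′

  n : ℕ
  n = 2 * v

  -- the test in firstRow v; for a cyclic distance d < 2v it says that v divides d
  multipleOfv : ℕ → Bool
  multipleOfv d = (d ≡ᵇ 0) ∨ (d ≡ᵇ v)

  n+J≡v+[v+J] : ∀ J → n + J ≡ v + (v + J)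
  n+J≡v+[v+J] J = trans (+-assoc v (v + 0) J) (cong (v +_) (cong (_+ J) (+-identityʳ v)))

  multipleOfv-≤ : ∀ A B → A ≤ B → B < v → multipleOfv (B ∸ A) ≡ (A ≡ᵇ B)
  multipleOfv-≤ A B A≤B B<v
    rewrite ≢⇒≡ᵇ≡false {B ∸ A} {v} (λ eq → <-irrefl eq (≤-<-trans (m∸n≤m B A) B<v)) | ∨-identityʳ (B ∸ A ≡ᵇ 0) =
    ≡ᵇ-iff (λ eq → sym (≤-antisym (m∸n≡0⇒m≤n eq) A≤B)) (λ eq → subst (λ t → B ∸ t ≡ 0) (sym eq) (n∸n≡0 B))

  multipleOfv-wrap : ∀ A B → A < v → B < A → multipleOfv ((n + B) ∸ A) ≡ false
  multipleOfv-wrap A B A<v B<A = cong₂ _∨_ (≢⇒≡ᵇ≡false {(n + B) ∸ A} {0} ≢0) (≢⇒≡ᵇ≡false {(n + B) ∸ A} {v} ≢v)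
    where
    A≤ : A ≤ n + B
    A≤ = ≤-trans (<⇒≤ A<v) (≤-trans (m≤m+n v (v + B)) (≤-reflexive (sym (n+J≡v+[v+J] B))))
    split : (n + B) ∸ A + A ≡ v + (v + B)
    split = trans (m∸n+n≡m A≤) (n+J≡v+[v+J] B)
    ≢0 : (n + B) ∸ A ≢ 0
    ≢0 eq = <-irrefl refl (<-≤-trans A<v (≤-trans (m≤m+n v (v + B)) (≤-reflexive (trans (sym split) (cong (_+ A) eq)))))
    ≢v : (n + B) ∸ A ≢ v
    ≢v eq = <-irrefl refl (<-≤-trans A<v (≤-trans (m≤m+n v B) (≤-reflexive (+-cancelˡ-≡ v (v + B) A (trans (sym split) (cong (_+ A) eq))))))

  multipleOfv-v+ : ∀ A B → A < v → B < v → multipleOfv ((v + B) ∸ A) ≡ (A ≡ᵇ B)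
  multipleOfv-v+ A B A<v B<v = trans (cong (_∨ ((v + B) ∸ A ≡ᵇ v)) (≢⇒≡ᵇ≡false {(v + B) ∸ A} {0} ≢0)) (≡ᵇ-iff ⇒ ⇐)
    where
    split : (v + B) ∸ A + A ≡ v + B
    split = m∸n+n≡m (≤-trans (<⇒≤ A<v) (m≤m+n v B))
    ≢0 : (v + B) ∸ A ≢ 0
    ≢0 eq = <-irrefl refl (<-≤-trans A<v (≤-trans (m≤m+n v B) (≤-reflexive (trans (sym split) (cong (_+ A) eq)))))
    ⇒ : (v + B) ∸ A ≡ v → A ≡ B
    ⇒ eq = sym (+-cancelˡ-≡ v B A (trans (sym split) (cong (_+ A) eq)))
    ⇐ : A ≡ B → (v + B) ∸ A ≡ v
    ⇐ refl = m+n∸n≡m v A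

  multipleOfv-diffMod : ∀ (i j : Fin n) → multipleOfv (diffMod i j) ≡ (residue (toℕ i) ≡ᵇ residue (toℕ j))
  multipleOfv-diffMod i j = go (toℕ i) (toℕ j) (toℕ<n i) (toℕ<n j)
    where
    go : ∀ I J → I < n → J < n →
      multipleOfv (if I ≤ᵇ J then J ∸ I else (n + J) ∸ I) ≡ (residue I ≡ᵇ residue J)
    go I J I<n J<n with I ≤ᵇ J in I≤ᵇJ | half I I<n | half J J<n
    ... | true  | top I<v | top J<v rewrite residue-top I<v | residue-top J<v =
      multipleOfv-≤ I J (≤ᵇ⇒≤ I J (subst T (sym I≤ᵇJ) tt)) J<v
    ... | false | top I<v | top J<v rewrite residue-top I<v | residue-top J<v
        | ≢⇒≡ᵇ≡false {I} {J} (λ eq → subst T I≤ᵇJ (≤⇒≤ᵇ (subst (I ≤_) eq ≤-refl))) =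
      multipleOfv-wrap I J I<v (≰⇒> (λ I≤J → subst T I≤ᵇJ (≤⇒≤ᵇ I≤J)))
    ... | true  | top I<v | bottom L L<v refl rewrite residue-top I<v | residue-bottom L = multipleOfv-v+ I L I<v L<v
    ... | false | top I<v | bottom L L<v refl = ⊥-elim (subst T I≤ᵇJ (≤⇒≤ᵇ (≤-trans (<⇒≤ I<v) (m≤m+n v L))))
    ... | true  | bottom K K<v refl | top J<v =
      ⊥-elim (<-irrefl refl (<-≤-trans J<v (≤-trans (m≤m+n v K) (≤ᵇ⇒≤ (v + K) J (subst T (sym I≤ᵇJ) tt)))))
    ... | false | bottom K K<v refl | top J<v rewrite residue-top J<v | residue-bottom K
        | cong (_∸ (v + K)) (n+J≡v+[v+J] J) | [m+n]∸[m+o]≡n∸o v (v + J) K = multipleOfv-v+ K J K<v J<v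
    ... | true  | bottom K K<v refl | bottom L L<v refl rewrite residue-bottom K | residue-bottom L | [m+n]∸[m+o]≡n∸o v L K =
      multipleOfv-≤ K L (+-cancelˡ-≤ v K L (≤ᵇ⇒≤ (v + K) (v + L) (subst T (sym I≤ᵇJ) tt))) L<v
    ... | false | bottom K K<v refl | bottom L L<v refl rewrite residue-bottom K | residue-bottom L
        | ≢⇒≡ᵇ≡false {K} {L} (λ eq → subst T I≤ᵇJ (≤⇒≤ᵇ (subst (λ t → v + K ≤ v + t) eq ≤-refl)))
        | cong (_∸ (v + K)) (n+J≡v+[v+J] (v + L)) | [m+n]∸[m+o]≡n∸o v (v + (v + L)) K | sym (n+J≡v+[v+J] L) =
      multipleOfv-wrap K L K<v (+-cancelˡ-< v L K (≰⇒> (λ v+K≤v+L → subst T I≤ᵇJ (≤⇒≤ᵇ v+K≤v+L))))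

  circulant-firstRow : ∀ (i j : Fin n) →
    circulant n (firstRow v) i j ≡ (if residue (toℕ i) ≡ᵇ residue (toℕ j) then v ∸ 1 else 1)
  circulant-firstRow i j = cong (λ b → if b then v ∸ 1 else 1) (multipleOfv-diffMod i j)

module Determinant where
  open import Data.Nat as ℕ using (ℕ; zero; suc; _<_; _≤_; _<ᵇ_; _∸_; z≤n; s≤s)
  import Data.Nat.Properties as ℕ
  open import Data.Integer as ℤ using (ℤ; +_; _+_; _*_; -_; _-_; _^_)
  import Data.Integer.Properties as ℤ
  open import Data.Integer.Tactic.RingSolver using (solve-∀)
  open import Data.Fin as Fin using (Fin; zero; suc; toℕ; punchIn)
  open import Data.Fin.Properties using (punchInᵢ≢i; suc-injective; toℕ-fromℕ<; toℕ-injective; toℕ<n)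
  open import Data.Empty using (⊥-elim)
  open import Data.Bool using (true; false; if_then_else_)
  open import Data.Sum using (_⊎_; inj₁; inj₂)
  open import Function using (_∘_)
  open import Relation.Binary.PropositionalEquality
  open import Relation.Nullary using (yes; no)
  open import Algebra.Properties.Semiring.Sum ℤ.+-*-semiring
    using (sum; sum-syntax; sum-cong-≗; sum-remove; ∑-comm; ∑-distrib-+; *-distribˡ-sum; *-distribʳ-sum)
  open SemiringSums ℤ.+-*-semiring using (∑-zero; ∑-single) public

  private variable n : ℕ

  sumℤ≡sum : (f : Fin n → ℤ) → sumℤ f ≡ sum f
  sumℤ≡sum {zero}  f = refl
  sumℤ≡sum {suc n} f = cong (_+_ (f zero)) (sumℤ≡sum (f ∘ suc))

  ∑-negate : (f : Fin n → ℤ) → ∑[ i < n ] (- f i) ≡ - sum f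
  ∑-negate {zero}  f = refl
  ∑-negate {suc n} f = trans (cong (_+_ (- f zero)) (∑-negate (f ∘ suc))) (sym (ℤ.neg-distrib-+ (f zero) _))

  ∑-combination : ∀ {m} (x : Fin n → ℤ) (w : Fin m → ℤ) (y : Fin m → Fin n → ℤ) →
    ∑[ j < n ] (x j + ∑[ p < m ] (w p * y p j)) ≡ sum x + ∑[ p < m ] (w p * ∑[ j < n ] y p j)
  ∑-combination x w y = begin
    ∑[ j < _ ] (x j + ∑[ p < _ ] (w p * y p j))
      ≡⟨ ∑-distrib-+ x _ ⟩
    sum x + ∑[ j < _ ] ∑[ p < _ ] (w p * y p j)
      ≡⟨ cong (_+_ (sum x)) (∑-comm (λ j p → w p * y p j)) ⟩
    sum x + ∑[ p < _ ] ∑[ j < _ ] (w p * y p j)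
      ≡⟨ cong (_+_ (sum x)) (sum-cong-≗ λ p → sym (*-distribˡ-sum (w p) (y p))) ⟩
    sum x + ∑[ p < _ ] (w p * ∑[ j < _ ] y p j) ∎
    where open ≡-Reasoning

  Matrix : ℕ → Set
  Matrix n = Fin n → Fin n → ℤ

  sign : ℕ → ℤ
  sign k = (- + 1) ℤ.^ k

  minor : Matrix (suc n) → Fin (suc n) → Matrix n
  minor M j i k = M (suc i) (punchIn j k)

  cofactor : Matrix (suc n) → Fin (suc n) → ℤ
  cofactor {n} M j = sign (toℕ j) * det n (minor M j)

  det-suc : (M : Matrix (suc n)) → det (suc n) M ≡ ∑[ j < suc n ] (M zero j * cofactor M j)
  det-suc {n} M = trans (sumℤ≡sum λ j → sign (toℕ j) * M zero j * det n (minor M j))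
                        (sum-cong-≗ λ j → reassoc (sign (toℕ j)) (M zero j) (det n (minor M j)))
    where
    reassoc : ∀ s a d → s * a * d ≡ a * (s * d)
    reassoc = solve-∀

  det-cong : ∀ n {A B : Matrix n} → (∀ i j → A i j ≡ B i j) → det n A ≡ det n B
  det-cong zero    A≡B = refl
  det-cong (suc n) {A} {B} A≡B = begin
    det (suc n) A
      ≡⟨ det-suc A ⟩
    ∑[ j < suc n ] (A zero j * cofactor A j)
      ≡⟨ sum-cong-≗ (λ j → cong₂ (λ a d → a * (sign (toℕ j) * d)) (A≡B zero j) (det-cong n λ i k → A≡B (suc i) (punchIn j k))) ⟩
    ∑[ j < suc n ] (B zero j * cofactor B j)
      ≡⟨ det-suc B ⟨
    det (suc n) B ∎
    where open ≡-Reasoning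

  det-termwise : (A C : Matrix (suc n)) → ∀ {m} (w : Fin m → ℤ) (B : Fin m → Matrix (suc n)) →
    (∀ j → A zero j * cofactor A j ≡ C zero j * cofactor C j + ∑[ p < m ] (w p * (B p zero j * cofactor (B p) j))) →
    det (suc n) A ≡ det (suc n) C + ∑[ p < m ] (w p * det (suc n) (B p))
  det-termwise {n} A C w B term = begin
    det (suc n) A
      ≡⟨ det-suc A ⟩
    ∑[ j < suc n ] (A zero j * cofactor A j)
      ≡⟨ sum-cong-≗ term ⟩
    ∑[ j < suc n ] (C zero j * cofactor C j + ∑[ p < _ ] (w p * (B p zero j * cofactor (B p) j)))
      ≡⟨ ∑-combination (λ j → C zero j * cofactor C j) w (λ p j → B p zero j * cofactor (B p) j) ⟩
    ∑[ j < suc n ] (C zero j * cofactor C j) + ∑[ p < _ ] (w p * ∑[ j < suc n ] (B p zero j * cofactor (B p) j))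
      ≡⟨ cong₂ _+_ (det-suc C) (sum-cong-≗ λ p → cong (w p *_) (det-suc (B p))) ⟨
    det (suc n) C + ∑[ p < _ ] (w p * det (suc n) (B p)) ∎
    where open ≡-Reasoning

  det-linear : ∀ n (r : Fin n) (A C : Matrix n) {m} (w : Fin m → ℤ) (B : Fin m → Matrix n) →
    (∀ j → A r j ≡ C r j + ∑[ p < m ] (w p * B p r j)) →
    (∀ i → i ≢ r → ∀ j → A i j ≡ C i j) →
    (∀ p i → i ≢ r → ∀ j → B p i j ≡ C i j) →
    det n A ≡ det n C + ∑[ p < m ] (w p * det n (B p))
  det-linear (suc n) zero A C w B rowʳ rowsA rowsB = det-termwise A C w B term
    where
    open ≡-Reasoning
    cofactorsA : ∀ j → cofactor A j ≡ cofactor C j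
    cofactorsA j = cong (sign (toℕ j) *_) (det-cong n λ i k → rowsA (suc i) (λ ()) _)
    cofactorsB : ∀ p j → cofactor (B p) j ≡ cofactor C j
    cofactorsB p j = cong (sign (toℕ j) *_) (det-cong n λ i k → rowsB p (suc i) (λ ()) _)
    term : ∀ j → A zero j * cofactor A j ≡ C zero j * cofactor C j + ∑[ p < _ ] (w p * (B p zero j * cofactor (B p) j))
    term j = begin
      A zero j * cofactor A j
        ≡⟨ cong₂ _*_ (rowʳ j) (cofactorsA j) ⟩
      (C zero j + ∑[ p < _ ] (w p * B p zero j)) * cofactor C j
        ≡⟨ ℤ.*-distribʳ-+ (cofactor C j) (C zero j) _ ⟩
      C zero j * cofactor C j + (∑[ p < _ ] (w p * B p zero j)) * cofactor C j
        ≡⟨ cong (_+_ (C zero j * cofactor C j)) (*-distribʳ-sum (cofactor C j) λ p → w p * B p zero j) ⟩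
      C zero j * cofactor C j + ∑[ p < _ ] (w p * B p zero j * cofactor C j)
        ≡⟨ cong (_+_ (C zero j * cofactor C j)) (sum-cong-≗ λ p →
             trans (ℤ.*-assoc (w p) _ _) (cong (λ c → w p * (B p zero j * c)) (sym (cofactorsB p j)))) ⟩
      C zero j * cofactor C j + ∑[ p < _ ] (w p * (B p zero j * cofactor (B p) j)) ∎
  det-linear (suc n) (suc r) A C w B rowʳ rowsA rowsB = det-termwise A C w B term
    where
    open ≡-Reasoning
    minors : ∀ j → det n (minor A j) ≡ det n (minor C j) + ∑[ p < _ ] (w p * det n (minor (B p) j))
    minors j = det-linear n r (minor A j) (minor C j) w (λ p → minor (B p) j) (λ k → rowʳ (punchIn j k))
      (λ i i≢r k → rowsA (suc i) (i≢r ∘ suc-injective) _) (λ p i i≢r k → rowsB p (suc i) (i≢r ∘ suc-injective) _)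
    term : ∀ j → A zero j * cofactor A j ≡ C zero j * cofactor C j + ∑[ p < _ ] (w p * (B p zero j * cofactor (B p) j))
    term j = begin
      A zero j * (s * det n (minor A j))
        ≡⟨ cong₂ (λ a d → a * (s * d)) (rowsA zero (λ ()) j) (minors j) ⟩
      a * (s * (det n (minor C j) + ∑[ p < _ ] (w p * det n (minor (B p) j))))
        ≡⟨ distribute a s (det n (minor C j)) _ ⟩
      a * cofactor C j + a * s * ∑[ p < _ ] (w p * det n (minor (B p) j))
        ≡⟨ cong (_+_ (a * cofactor C j)) (*-distribˡ-sum (a * s) λ p → w p * det n (minor (B p) j)) ⟩
      a * cofactor C j + ∑[ p < _ ] (a * s * (w p * det n (minor (B p) j)))
        ≡⟨ cong (_+_ (a * cofactor C j)) (sum-cong-≗ λ p →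
             trans (commute a s (w p) _) (cong (λ b → w p * (b * cofactor (B p) j)) (sym (rowsB p zero (λ ()) j)))) ⟩
      a * cofactor C j + ∑[ p < _ ] (w p * (B p zero j * cofactor (B p) j)) ∎
      where
      s = sign (toℕ j)
      a = C zero j
      distribute : ∀ a s c d → a * (s * (c + d)) ≡ a * (s * c) + a * s * d
      distribute = solve-∀
      commute : ∀ a s w d → a * s * (w * d) ≡ w * (a * (s * d))
      commute = solve-∀

  -- Total variant of punchOut: the index of b once a has been removed
  -- (for b = a the value is irrelevant).
  punchOut′ : Fin (suc (suc n)) → Fin (suc (suc n)) → Fin (suc n)
  punchOut′           zero    zero    = zero
  punchOut′           zero    (suc b) = b
  punchOut′           (suc a) zero    = zero
  punchOut′ {suc n}   (suc a) (suc b) = suc (punchOut′ a b)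
  punchOut′ {zero}    (suc a) (suc b) = zero

  punchOut′-punchIn : (a : Fin (suc (suc n))) (k : Fin (suc n)) → punchOut′ a (punchIn a k) ≡ k
  punchOut′-punchIn           zero    k       = refl
  punchOut′-punchIn           (suc a) zero    = refl
  punchOut′-punchIn {suc n}   (suc a) (suc k) = cong suc (punchOut′-punchIn a k)

  -- The l-th index different from both a and b.
  punchIn₂ : Fin (suc (suc n)) → Fin (suc (suc n)) → Fin n → Fin (suc (suc n))
  punchIn₂ a b l = punchIn a (punchIn (punchOut′ a b) l)

  punchIn₂-comm : (a b : Fin (suc (suc n))) → a ≢ b → ∀ l → punchIn₂ a b l ≡ punchIn₂ b a l
  punchIn₂-comm           zero    zero    a≢b l       = ⊥-elim (a≢b refl)
  punchIn₂-comm           zero    (suc b) a≢b l       = refl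
  punchIn₂-comm           (suc a) zero    a≢b l       = refl
  punchIn₂-comm {suc n}   (suc a) (suc b) a≢b zero    = refl
  punchIn₂-comm {suc n}   (suc a) (suc b) a≢b (suc l) = cong suc (punchIn₂-comm a b (a≢b ∘ cong suc) l)

  -- The sign with which the entries (0 , a) and (1 , b) occur in the expansion
  -- of a determinant along its first two rows.
  pairSign : Fin (suc (suc n)) → Fin (suc (suc n)) → ℤ
  pairSign a b = sign (toℕ a) * sign (toℕ (punchOut′ a b))

  pairSign-anti : (a b : Fin (suc (suc n))) → a ≢ b → pairSign a b ≡ - pairSign b a
  pairSign-anti           zero    zero    a≢b = ⊥-elim (a≢b refl)
  pairSign-anti           zero    (suc b) a≢b = lemma (sign (toℕ b))
    where lemma : ∀ s → + 1 * s ≡ - ((- + 1 * s) * + 1)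
          lemma = solve-∀
  pairSign-anti           (suc a) zero    a≢b = lemma (sign (toℕ a))
    where lemma : ∀ s → (- + 1 * s) * + 1 ≡ - (+ 1 * s)
          lemma = solve-∀
  pairSign-anti {suc n}   (suc a) (suc b) a≢b = begin
    (- + 1 * sign (toℕ a)) * (- + 1 * sign (toℕ (punchOut′ a b)))
      ≡⟨ lemma (sign (toℕ a)) (sign (toℕ (punchOut′ a b))) ⟩
    pairSign a b
      ≡⟨ pairSign-anti a b (a≢b ∘ cong suc) ⟩
    - pairSign b a
      ≡⟨ cong -_ (sym (lemma (sign (toℕ b)) (sign (toℕ (punchOut′ b a))))) ⟩
    - ((- + 1 * sign (toℕ b)) * (- + 1 * sign (toℕ (punchOut′ b a)))) ∎
    where
    open ≡-Reasoning
    lemma : ∀ s t → (- + 1 * s) * (- + 1 * t) ≡ s * t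
    lemma = solve-∀
  pairSign-anti {zero}    (suc zero) (suc zero) a≢b = ⊥-elim (a≢b refl)

  ∑-punchIn : (j : Fin (suc n)) (f : Fin (suc n) → ℤ) → ∑[ k < n ] f (punchIn j k) ≡ sum f - f j
  ∑-punchIn j f = begin
    ∑[ k < _ ] f (punchIn j k)               ≡⟨ cancel (f j) (∑[ k < _ ] f (punchIn j k)) ⟩
    f j + ∑[ k < _ ] f (punchIn j k) - f j   ≡⟨ cong (_- f j) (sym (sum-remove {i = j} f)) ⟩
    sum f - f j ∎
    where
    open ≡-Reasoning
    cancel : ∀ a s → s ≡ a + s - a
    cancel = solve-∀

  ∑-offDiagonal-transpose : (g : Fin (suc n) → Fin (suc n) → ℤ) →
    ∑[ j < suc n ] ∑[ k < n ] g j (punchIn j k) ≡ ∑[ j < suc n ] ∑[ k < n ] g (punchIn j k) j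
  ∑-offDiagonal-transpose g = begin
    ∑[ j < _ ] ∑[ k < _ ] g j (punchIn j k)          ≡⟨ offDiagonal g ⟩
    ∑[ j < _ ] sum (g j) - ∑[ j < _ ] g j j          ≡⟨ cong (_- ∑[ j < _ ] g j j) (∑-comm g) ⟩
    ∑[ j < _ ] ∑[ i < _ ] g i j - ∑[ j < _ ] g j j   ≡⟨ sym (offDiagonal λ a b → g b a) ⟩
    ∑[ j < _ ] ∑[ k < _ ] g (punchIn j k) j ∎
    where
    open ≡-Reasoning
    offDiagonal : (h : Fin (suc _) → Fin (suc _) → ℤ) →
      ∑[ j < _ ] ∑[ k < _ ] h j (punchIn j k) ≡ ∑[ j < _ ] sum (h j) - ∑[ j < _ ] h j j
    offDiagonal h = begin
      ∑[ j < _ ] ∑[ k < _ ] h j (punchIn j k)        ≡⟨ sum-cong-≗ (λ j → ∑-punchIn j (h j)) ⟩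
      ∑[ j < _ ] (sum (h j) - h j j)                 ≡⟨ ∑-distrib-+ (λ j → sum (h j)) (λ j → - h j j) ⟩
      ∑[ j < _ ] sum (h j) + ∑[ j < _ ] (- h j j)    ≡⟨ cong (_+_ (∑[ j < _ ] sum (h j))) (∑-negate λ j → h j j) ⟩
      ∑[ j < _ ] sum (h j) - ∑[ j < _ ] h j j ∎

  swapRows₀₁ : Matrix (suc (suc n)) → Matrix (suc (suc n))
  swapRows₀₁ A zero          = A (suc zero)
  swapRows₀₁ A (suc zero)    = A zero
  swapRows₀₁ A (suc (suc i)) = A (suc (suc i))

  pairTerm : Matrix (suc (suc n)) → Fin (suc (suc n)) → Fin (suc (suc n)) → ℤ
  pairTerm {n} A a b = pairSign a b * (A zero a * A (suc zero) b) * det n (λ i l → A (suc (suc i)) (punchIn₂ a b l))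

  det-expand₂ : (A : Matrix (suc (suc n))) →
    det (suc (suc n)) A ≡ ∑[ j < suc (suc n) ] ∑[ k < suc n ] pairTerm A j (punchIn j k)
  det-expand₂ {n} A = begin
    det (suc (suc n)) A
      ≡⟨ sumℤ≡sum (λ j → s j * A zero j * det (suc n) (minor A j)) ⟩
    ∑[ j < _ ] (s j * A zero j * det (suc n) (minor A j))
      ≡⟨ sum-cong-≗ (λ j → trans (cong (_*_ (s j * A zero j)) (sumℤ≡sum (inner j))) (*-distribˡ-sum (s j * A zero j) (inner j))) ⟩
    ∑[ j < _ ] ∑[ k < _ ] (s j * A zero j * inner j k)
      ≡⟨ sum-cong-≗ (λ j → sum-cong-≗ (term j)) ⟩
    ∑[ j < _ ] ∑[ k < _ ] pairTerm A j (punchIn j k) ∎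
    where
    open ≡-Reasoning
    s : ∀ {m} → Fin m → ℤ
    s j = sign (toℕ j)
    rest : Fin (suc (suc n)) → Fin (suc n) → ℤ
    rest j k = det n (λ i l → A (suc (suc i)) (punchIn j (punchIn k l)))
    inner : Fin (suc (suc n)) → Fin (suc n) → ℤ
    inner j k = s k * A (suc zero) (punchIn j k) * rest j k
    reorder : ∀ sj a sk b d → sj * a * (sk * b * d) ≡ sj * sk * (a * b) * d
    reorder = solve-∀
    term : ∀ j k → s j * A zero j * inner j k ≡ pairTerm A j (punchIn j k)
    term j k = begin
      s j * A zero j * inner j k
        ≡⟨ reorder (s j) (A zero j) (s k) (A (suc zero) (punchIn j k)) (rest j k) ⟩
      s j * s k * (A zero j * A (suc zero) (punchIn j k)) * rest j k
        ≡⟨ cong (λ c → s j * s c * (A zero j * A (suc zero) (punchIn j k)) * rest j c) (sym (punchOut′-punchIn j k)) ⟩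
      pairTerm A j (punchIn j k) ∎

  det-swapRows₀₁ : (A : Matrix (suc (suc n))) → det (suc (suc n)) (swapRows₀₁ A) ≡ - det (suc (suc n)) A
  det-swapRows₀₁ {n} A = begin
    det (suc (suc n)) (swapRows₀₁ A)
      ≡⟨ det-expand₂ (swapRows₀₁ A) ⟩
    ∑[ j < _ ] ∑[ k < _ ] pairTerm (swapRows₀₁ A) j (punchIn j k)
      ≡⟨ sum-cong-≗ (λ j → sum-cong-≗ λ k → transposed j (punchIn j k) (punchInᵢ≢i j k ∘ sym)) ⟩
    ∑[ j < _ ] ∑[ k < _ ] (- pairTerm A (punchIn j k) j)
      ≡⟨ sum-cong-≗ (λ j → ∑-negate λ k → pairTerm A (punchIn j k) j) ⟩
    ∑[ j < _ ] (- ∑[ k < _ ] pairTerm A (punchIn j k) j)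
      ≡⟨ ∑-negate (λ j → ∑[ k < _ ] pairTerm A (punchIn j k) j) ⟩
    - ∑[ j < _ ] ∑[ k < _ ] pairTerm A (punchIn j k) j
      ≡⟨ cong -_ (sym (∑-offDiagonal-transpose (pairTerm A))) ⟩
    - ∑[ j < _ ] ∑[ k < _ ] pairTerm A j (punchIn j k)
      ≡⟨ cong -_ (sym (det-expand₂ A)) ⟩
    - det (suc (suc n)) A ∎
    where
    open ≡-Reasoning
    rest : Fin (suc (suc n)) → Fin (suc (suc n)) → ℤ
    rest a b = det n (λ i l → A (suc (suc i)) (punchIn₂ a b l))
    flip-signs : ∀ s p q r → - s * (q * p) * r ≡ - (s * (p * q) * r)
    flip-signs = solve-∀
    transposed : ∀ a b → a ≢ b → pairTerm (swapRows₀₁ A) a b ≡ - pairTerm A b a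
    transposed a b a≢b = begin
      pairSign a b * (A (suc zero) a * A zero b) * rest a b
        ≡⟨ cong₂ (λ σ r → σ * (A (suc zero) a * A zero b) * r) (pairSign-anti a b a≢b)
             (det-cong n λ i l → cong (A (suc (suc i))) (punchIn₂-comm a b a≢b l)) ⟩
      - pairSign b a * (A (suc zero) a * A zero b) * rest b a
        ≡⟨ flip-signs (pairSign b a) (A zero b) (A (suc zero) a) (rest b a) ⟩
      - pairTerm A b a ∎

  x≡-x⇒x≡0 : ∀ {x} → x ≡ - x → x ≡ + 0
  x≡-x⇒x≡0 {+ zero}    _  = refl
  x≡-x⇒x≡0 {+ suc _}   ()
  x≡-x⇒x≡0 {ℤ.-[1+ _ ]} ()

  mutual
    det-equalRows : ∀ n (A : Matrix n) {i j} → i ≢ j → (∀ k → A i k ≡ A j k) → det n A ≡ + 0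
    det-equalRows (suc n) A {zero}  {zero}  i≢j _  = ⊥-elim (i≢j refl)
    det-equalRows (suc n) A {zero}  {suc j} _   eq = det-equalRow₀ n A j eq
    det-equalRows (suc n) A {suc i} {zero}  _   eq = det-equalRow₀ n A i (sym ∘ eq)
    det-equalRows (suc n) A {suc i} {suc j} i≢j eq = det-equalRows-suc n A (i≢j ∘ cong suc) eq

    det-equalRow₀ : ∀ n (A : Matrix (suc n)) j → (∀ k → A zero k ≡ A (suc j) k) → det (suc n) A ≡ + 0
    det-equalRow₀ (suc n) A zero eq = x≡-x⇒x≡0 (trans (sym (det-cong (suc (suc n)) swapped≡A)) (det-swapRows₀₁ A))
      where
      swapped≡A : ∀ i k → swapRows₀₁ A i k ≡ A i k
      swapped≡A zero          k = sym (eq k)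
      swapped≡A (suc zero)    k = eq k
      swapped≡A (suc (suc i)) k = refl
    det-equalRow₀ (suc n) A (suc j) eq = begin
      det (suc (suc n)) A
        ≡⟨ sym (ℤ.neg-involutive _) ⟩
      - - det (suc (suc n)) A
        ≡⟨ cong -_ (sym (det-swapRows₀₁ A)) ⟩
      - det (suc (suc n)) (swapRows₀₁ A)
        ≡⟨ cong -_ (det-equalRows-suc (suc n) (swapRows₀₁ A) {zero} {suc j} (λ ()) eq) ⟩
      + 0 ∎
      where open ≡-Reasoning

    det-equalRows-suc : ∀ n (A : Matrix (suc n)) {i j} → i ≢ j → (∀ k → A (suc i) k ≡ A (suc j) k) → det (suc n) A ≡ + 0
    det-equalRows-suc n A i≢j eq = trans (det-suc A) (∑-zero λ c →
      trans (cong (λ d → A zero c * (sign (toℕ c) * d)) (det-equalRows n (minor A c) i≢j λ k → eq (punchIn c k)))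
            (lemma (A zero c) (sign (toℕ c))))
      where
      lemma : ∀ a s → a * (s * + 0) ≡ + 0
      lemma = solve-∀

  replaceRow : Matrix n → Fin n → Fin n → Matrix n
  replaceRow A r p i with i Fin.≟ r
  ... | yes _ = A p
  ... | no  _ = A i

  replaceRow-≡ : (A : Matrix n) (r p : Fin n) → replaceRow A r p r ≡ A p
  replaceRow-≡ A r p with r Fin.≟ r
  ... | yes _   = refl
  ... | no  r≢r = ⊥-elim (r≢r refl)

  replaceRow-≢ : (A : Matrix n) {r i : Fin n} (p : Fin n) → i ≢ r → replaceRow A r p i ≡ A i
  replaceRow-≢ A {r} {i} p i≢r with i Fin.≟ r
  ... | yes i≡r = ⊥-elim (i≢r i≡r)
  ... | no  _   = refl

  det-addCombination : ∀ n (A A′ : Matrix n) (r : Fin n) (w : Fin n → ℤ) → w r ≡ + 0 →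
    (∀ j → A′ r j ≡ A r j + ∑[ p < n ] (w p * A p j)) →
    (∀ i → i ≢ r → ∀ j → A′ i j ≡ A i j) →
    det n A′ ≡ det n A
  det-addCombination n A A′ r w wᵣ≡0 rowʳ rows = begin
    det n A′
      ≡⟨ det-linear n r A′ A w (replaceRow A r) rowʳ′ rows (λ p i i≢r j → cong (λ row → row j) (replaceRow-≢ A p i≢r)) ⟩
    det n A + ∑[ p < n ] (w p * det n (replaceRow A r p))
      ≡⟨ cong (_+_ (det n A)) (∑-zero vanishes) ⟩
    det n A + + 0
      ≡⟨ ℤ.+-identityʳ _ ⟩
    det n A ∎
    where
    open ≡-Reasoning
    rowʳ′ : ∀ j → A′ r j ≡ A r j + ∑[ p < n ] (w p * replaceRow A r p r j)
    rowʳ′ j = trans (rowʳ j) (cong (_+_ (A r j)) (sum-cong-≗ λ p → cong (λ row → w p * row j) (sym (replaceRow-≡ A r p))))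
    vanishes : ∀ p → w p * det n (replaceRow A r p) ≡ + 0
    vanishes p with p Fin.≟ r
    ... | yes refl = cong (_* det n (replaceRow A p p)) wᵣ≡0
    ... | no  p≢r  = trans (cong (w p *_) (det-equalRows n (replaceRow A r p) (p≢r ∘ sym) λ k →
                       trans (cong (λ row → row k) (replaceRow-≡ A r p)) (sym (cong (λ row → row k) (replaceRow-≢ A p p≢r)))))
                       (ℤ.*-zeroʳ (w p))

  -- Several rows may receive combinations at once, provided every row that is
  -- used with a nonzero coefficient is itself left unchanged.
  module _ {n} (A : Matrix n) (w : Fin n → Fin n → ℤ)
           (sourcesUnchanged : ∀ r p → w r p ≡ + 0 ⊎ (∀ q → w p q ≡ + 0)) where

    private
      combination : Fin n → Fin n → ℤ
      combination r j = ∑[ p < n ] (w r p * A p j)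

      partial : ℕ → Matrix n
      partial t r j = A r j + (if toℕ r ℕ.<ᵇ t then combination r j else + 0)

      partial-source : ∀ p → (∀ q → w p q ≡ + 0) → ∀ t j → partial t p j ≡ A p j
      partial-source p wₚ≡0 t j = trans (cong (_+_ (A p j)) (noCombination (toℕ p ℕ.<ᵇ t))) (ℤ.+-identityʳ _)
        where
        noCombination : ∀ b → (if b then combination p j else + 0) ≡ + 0
        noCombination false = refl
        noCombination true  = ∑-zero λ q → cong (_* A q j) (wₚ≡0 q)

      det-partial-suc : ∀ t → t ℕ.< n → det n (partial (suc t)) ≡ det n (partial t)
      det-partial-suc t t<n = det-addCombination n (partial t) (partial (suc t)) r (w r) wᵣᵣ≡0 rowʳ rows
        where
        r = Fin.fromℕ< t<n
        toℕ-r : toℕ r ≡ t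
        toℕ-r = toℕ-fromℕ< t<n
        wᵣᵣ≡0 : w r r ≡ + 0
        wᵣᵣ≡0 with sourcesUnchanged r r
        ... | inj₁ wᵣᵣ≡0 = wᵣᵣ≡0
        ... | inj₂ wᵣ≡0  = wᵣ≡0 r
        sameTerm : ∀ j p → w r p * A p j ≡ w r p * partial t p j
        sameTerm j p with sourcesUnchanged r p
        ... | inj₁ wᵣₚ≡0 = trans (cong (_* A p j) wᵣₚ≡0) (sym (cong (_* partial t p j) wᵣₚ≡0))
        ... | inj₂ wₚ≡0  = cong (w r p *_) (sym (partial-source p wₚ≡0 t j))
        rowʳ : ∀ j → partial (suc t) r j ≡ partial t r j + ∑[ p < n ] (w r p * partial t p j)
        rowʳ j rewrite toℕ-r | <ᵇ-suc-self t | <ᵇ-irrefl t =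
          cong₂ _+_ (sym (ℤ.+-identityʳ (A r j))) (sum-cong-≗ (sameTerm j))
        rows : ∀ i → i ≢ r → ∀ j → partial (suc t) i j ≡ partial t i j
        rows i i≢r j rewrite <ᵇ-suc (toℕ i) t (λ eq → i≢r (toℕ-injective (trans eq (sym toℕ-r)))) = refl

      det-partial : ∀ t → t ℕ.≤ n → det n (partial t) ≡ det n A
      det-partial zero    _   = det-cong n λ i j → ℤ.+-identityʳ _
      det-partial (suc t) t<n = trans (det-partial-suc t t<n) (det-partial t (ℕ.<⇒≤ t<n))

    det-addCombinations : det n (λ r j → A r j + ∑[ p < n ] (w r p * A p j)) ≡ det n A
    det-addCombinations = trans (det-cong n complete) (det-partial n ℕ.≤-refl)
      where
      complete : ∀ r j → A r j + ∑[ p < n ] (w r p * A p j) ≡ partial n r j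
      complete r j with toℕ r ℕ.<ᵇ n | ℕ.<⇒<ᵇ (toℕ<n r)
      ... | true | _ = refl

  ∏ : (Fin n → ℤ) → ℤ
  ∏ {zero}  f = + 1
  ∏ {suc n} f = f zero * ∏ (f ∘ suc)

  ∏-cong : {f g : Fin n → ℤ} → (∀ i → f i ≡ g i) → ∏ f ≡ ∏ g
  ∏-cong {zero}  f≡g = refl
  ∏-cong {suc n} f≡g = cong₂ _*_ (f≡g zero) (∏-cong (f≡g ∘ suc))

  ∏-ones : {f : Fin n → ℤ} → (∀ i → f i ≡ + 1) → ∏ f ≡ + 1
  ∏-ones {zero}  f≡1 = refl
  ∏-ones {suc n} f≡1 = cong₂ _*_ (f≡1 zero) (∏-ones (f≡1 ∘ suc))

  det-scaleRows : ∀ n (A B : Matrix n) (s : Fin n → ℤ) → (∀ r j → A r j ≡ s r * B r j) → det n A ≡ ∏ s * det n B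
  det-scaleRows zero    A B s A≡sB = sym (ℤ.*-identityˡ _)
  det-scaleRows (suc n) A B s A≡sB = begin
    det (suc n) A
      ≡⟨ det-suc A ⟩
    ∑[ j < suc n ] (A zero j * cofactor A j)
      ≡⟨ sum-cong-≗ term ⟩
    ∑[ j < suc n ] (∏ s * (B zero j * cofactor B j))
      ≡⟨ sym (*-distribˡ-sum (∏ s) λ j → B zero j * cofactor B j) ⟩
    ∏ s * ∑[ j < suc n ] (B zero j * cofactor B j)
      ≡⟨ cong (∏ s *_) (sym (det-suc B)) ⟩
    ∏ s * det (suc n) B ∎
    where
    open ≡-Reasoning
    reorder : ∀ s₀ b σ sₜ d → s₀ * b * (σ * (sₜ * d)) ≡ s₀ * sₜ * (b * (σ * d))
    reorder = solve-∀
    term : ∀ j → A zero j * cofactor A j ≡ ∏ s * (B zero j * cofactor B j)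
    term j = begin
      A zero j * (sign (toℕ j) * det n (minor A j))
        ≡⟨ cong₂ (λ a d → a * (sign (toℕ j) * d)) (A≡sB zero j)
             (det-scaleRows n (minor A j) (minor B j) (s ∘ suc) λ r k → A≡sB (suc r) (punchIn j k)) ⟩
      s zero * B zero j * (sign (toℕ j) * (∏ (s ∘ suc) * det n (minor B j)))
        ≡⟨ reorder (s zero) (B zero j) (sign (toℕ j)) (∏ (s ∘ suc)) (det n (minor B j)) ⟩
      ∏ s * (B zero j * cofactor B j) ∎

  det-lowerTriangular : ∀ n (A : Matrix n) → (∀ i j → toℕ i ℕ.< toℕ j → A i j ≡ + 0) → det n A ≡ ∏ (λ i → A i i)
  det-lowerTriangular zero    A upper≡0 = refl
  det-lowerTriangular (suc n) A upper≡0 = begin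
    det (suc n) A
      ≡⟨ det-suc A ⟩
    A zero zero * cofactor A zero + ∑[ j < n ] (A zero (suc j) * cofactor A (suc j))
      ≡⟨ cong₂ _+_ (cong (λ d → A zero zero * (+ 1 * d)) minor₀) (∑-zero λ j → cong (_* cofactor A (suc j)) (upper≡0 zero (suc j) ℕ.z<s)) ⟩
    A zero zero * (+ 1 * ∏ (λ i → A (suc i) (suc i))) + + 0
      ≡⟨ tidy (A zero zero) _ ⟩
    ∏ (λ i → A i i) ∎
    where
    open ≡-Reasoning
    minor₀ : det n (minor A zero) ≡ ∏ (λ i → A (suc i) (suc i))
    minor₀ = det-lowerTriangular n (minor A zero) λ i j i<j → upper≡0 (suc i) (suc j) (ℕ.s<s i<j)
    tidy : ∀ a p → a * (+ 1 * p) + + 0 ≡ a * p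
    tidy = solve-∀

  ∑-initialSegment : ∀ {n} (c : ℤ) k → k ≤ n → ∑[ p < n ] (if toℕ p <ᵇ k then c else + 0) ≡ + k * c
  ∑-initialSegment {n}     c zero    _         = ∑-zero {n} λ _ → refl
  ∑-initialSegment {suc n} c (suc k) (s≤s k≤n) = trans (cong (_+_ c) (∑-initialSegment {n} c k k≤n)) (lemma c (+ k))
    where
    lemma : ∀ c k → c + k * c ≡ (+ 1 + k) * c
    lemma = solve-∀

  ∏-initialSegment : ∀ {n} (a b : ℤ) k → k ≤ n → ∏ {n} (λ r → if toℕ r <ᵇ k then a else b) ≡ a ^ k * b ^ (n ∸ k)
  ∏-initialSegment {zero}  a b zero    _         = refl
  ∏-initialSegment {suc n} a b zero    _         = trans (cong (b *_) (∏-initialSegment {n} a b zero z≤n)) (lemma b (b ^ n))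
    where
    lemma : ∀ b p → b * (+ 1 * p) ≡ + 1 * (b * p)
    lemma = solve-∀
  ∏-initialSegment {suc n} a b (suc k) (s≤s k≤n) = trans (cong (a *_) (∏-initialSegment {n} a b k k≤n)) (sym (ℤ.*-assoc a _ _))

module CharacteristicMatrix (v′ : ℕ) (x : ℤ) where
  open import Data.Nat as ℕ using (ℕ; zero; suc; _<_; _≡ᵇ_; _<ᵇ_; _∸_; z<s)
  import Data.Nat.Properties as ℕ
  open import Data.Integer as ℤ using (ℤ; +_; _+_; _*_; -_; _-_; _^_)
  import Data.Integer.Properties as ℤ
  open import Data.Integer.Tactic.RingSolver using (solve-∀)
  open import Data.Fin as Fin using (Fin; zero; suc; toℕ)
  open import Data.Fin.Properties using (toℕ<n)
  open import Data.Bool using (Bool; true; false; if_then_else_)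
  open import Data.Sum using (_⊎_; inj₁; inj₂)
  open import Data.Empty using (⊥-elim)
  open import Function using (_∘_)
  open import Relation.Binary.PropositionalEquality
  open import Algebra.Properties.Semiring.Sum ℤ.+-*-semiring using (sum-syntax; sum-cong-≗)
  open Determinant

  open Halves v′

  indicator : Bool → ℤ
  indicator b = if b then + 1 else + 0

  n : ℕ
  n = 2 ℕ.* v

  q : ℤ
  q = + v′

  toMatrix : (ℕ → ℕ → ℤ) → Matrix n
  toMatrix F i j = F (toℕ i) (toℕ j)

  M₀ : ℕ → ℕ → ℤ
  M₀ I J = (if I ≡ᵇ J then x else + 0) - + (if residue I ≡ᵇ residue J then v ∸ 1 else 1)

  -- Step 1: subtract from each bottom row v + K the top row K, and take out the factor x.
  w₁ : ℕ → ℕ → ℤ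
  w₁ R P = if isTop R then + 0 else (if P ≡ᵇ residue R then - + 1 else + 0)

  s₁ : ℕ → ℤ
  s₁ R = if isTop R then + 1 else x

  M₁ : ℕ → ℕ → ℤ
  M₁ I J = if isTop I then M₀ I J else (indicator (I ≡ᵇ J) - indicator (residue I ≡ᵇ J))

  differenceOfRows : ∀ b₁ b₂ c → (if b₁ then x else + 0) - c + - + 1 * ((if b₂ then x else + 0) - c) ≡ x * (indicator b₁ - indicator b₂)
  differenceOfRows true  true  c = lemma x c
    where lemma : ∀ x c → x - c + - + 1 * (x - c) ≡ x * (+ 1 - + 1)
          lemma = solve-∀
  differenceOfRows true  false c = lemma x c
    where lemma : ∀ x c → x - c + - + 1 * (+ 0 - c) ≡ x * (+ 1 - + 0)
          lemma = solve-∀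
  differenceOfRows false true  c = lemma x c
    where lemma : ∀ x c → + 0 - c + - + 1 * (x - c) ≡ x * (+ 0 - + 1)
          lemma = solve-∀
  differenceOfRows false false c = lemma x c
    where lemma : ∀ x c → + 0 - c + - + 1 * (+ 0 - c) ≡ x * (+ 0 - + 0)
          lemma = solve-∀

  step₁ : ∀ R J → R < n → M₀ R J + ∑[ p < n ] (w₁ R (toℕ p) * M₀ (toℕ p) J) ≡ s₁ R * M₁ R J
  step₁ R J R<n with half R R<n
  ... | top R<v = begin
    M₀ R J + ∑[ p < n ] (w₁ R (toℕ p) * M₀ (toℕ p) J)  ≡⟨ cong (_+_ (M₀ R J)) (∑-zero {n} λ p → noTerm (toℕ p)) ⟩
    M₀ R J + + 0                                       ≡⟨ ℤ.+-identityʳ _ ⟩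
    M₀ R J                                             ≡⟨ unchanged ⟩
    s₁ R * M₁ R J ∎
    where
    open ≡-Reasoning
    noTerm : ∀ P → w₁ R P * M₀ P J ≡ + 0
    noTerm P rewrite isTop-top R<v = refl
    unchanged : M₀ R J ≡ s₁ R * M₁ R J
    unchanged rewrite isTop-top R<v = sym (ℤ.*-identityˡ _)
  ... | bottom K K<v refl = begin
    M₀ (v ℕ.+ K) J + ∑[ p < n ] (w₁ (v ℕ.+ K) (toℕ p) * M₀ (toℕ p) J)
      ≡⟨ cong (_+_ (M₀ (v ℕ.+ K) J)) (∑-single (λ P → w₁ (v ℕ.+ K) P * M₀ P J) K (ℕ.<-≤-trans K<v (ℕ.m≤m+n v _)) noTerm) ⟩
    M₀ (v ℕ.+ K) J + w₁ (v ℕ.+ K) K * M₀ K J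
      ≡⟨ difference ⟩
    s₁ (v ℕ.+ K) * M₁ (v ℕ.+ K) J ∎
    where
    open ≡-Reasoning
    noTerm : ∀ Q → Q < n → Q ≢ K → w₁ (v ℕ.+ K) Q * M₀ Q J ≡ + 0
    noTerm Q _ Q≢K rewrite isTop-bottom K | residue-bottom K | ≢⇒≡ᵇ≡false Q≢K = refl
    difference : M₀ (v ℕ.+ K) J + w₁ (v ℕ.+ K) K * M₀ K J ≡ s₁ (v ℕ.+ K) * M₁ (v ℕ.+ K) J
    difference rewrite isTop-bottom K | residue-bottom K | ≡ᵇ-refl K | residue-top K<v =
      differenceOfRows (v ℕ.+ K ≡ᵇ J) (K ≡ᵇ J) _

  -- Step 2: clear the top-right block by adding to each top row suitable
  -- multiples of the bottom rows, which are now e (v + K) − e K.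
  w₂ : ℕ → ℕ → ℤ
  w₂ R P = if isTop R then (if isTop P then + 0 else + (if residue R ≡ᵇ residue P then v′ else 1)) else + 0

  M₂ : ℕ → ℕ → ℤ
  M₂ I J = if isTop I then (if isTop J then (if I ≡ᵇ J then x - (q + q) else - + 2) else + 0) else M₁ I J

  step₂-bottom : ∀ K J → M₁ (v ℕ.+ K) J + ∑[ p < n ] (w₂ (v ℕ.+ K) (toℕ p) * M₁ (toℕ p) J) ≡ M₂ (v ℕ.+ K) J
  step₂-bottom K J = trans (cong (_+_ (M₁ (v ℕ.+ K) J)) (∑-zero {n} λ p → noTerm (toℕ p))) (trans (ℤ.+-identityʳ _) unchanged)
    where
    noTerm : ∀ Q → w₂ (v ℕ.+ K) Q * M₁ Q J ≡ + 0
    noTerm Q rewrite isTop-bottom K = refl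
    unchanged : M₁ (v ℕ.+ K) J ≡ M₂ (v ℕ.+ K) J
    unchanged rewrite isTop-bottom K = refl

  step₂-topRight : ∀ {R} L → R < v → L < v → v ℕ.+ L < n →
    M₁ R (v ℕ.+ L) + ∑[ p < n ] (w₂ R (toℕ p) * M₁ (toℕ p) (v ℕ.+ L)) ≡ M₂ R (v ℕ.+ L)
  step₂-topRight {R} L R<v L<v v+L<n =
    trans (cong (_+_ (M₁ R (v ℕ.+ L))) (∑-single (λ P → w₂ R P * M₁ P (v ℕ.+ L)) (v ℕ.+ L) v+L<n noTerm)) cleared
    where
    noTerm : ∀ Q → Q < n → Q ≢ v ℕ.+ L → w₂ R Q * M₁ Q (v ℕ.+ L) ≡ + 0
    noTerm Q Q<n Q≢v+L with half Q Q<n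
    ... | top Q<v rewrite isTop-top R<v | isTop-top Q<v = refl
    ... | bottom K K<v refl rewrite isTop-bottom K | residue-bottom K | ≡ᵇ-cancelˡ v K L
        | ≢⇒≡ᵇ≡false (Q≢v+L ∘ cong (v ℕ.+_)) | ≢⇒≡ᵇ≡false (top≢bottom L K<v ∘ sym) =
      ℤ.*-zeroʳ (if isTop R then + (if residue R ≡ᵇ K then v′ else 1) else + 0)
    cleared : M₁ R (v ℕ.+ L) + w₂ R (v ℕ.+ L) * M₁ (v ℕ.+ L) (v ℕ.+ L) ≡ M₂ R (v ℕ.+ L)
    cleared rewrite isTop-top R<v | isTop-bottom L | residue-top R<v | residue-bottom L | ≡ᵇ-refl (v ℕ.+ L)
      | ≢⇒≡ᵇ≡false (top≢bottom L L<v ∘ sym) | ≢⇒≡ᵇ≡false (top≢bottom L R<v ∘ sym) = lemma (+ (if R ≡ᵇ L then v′ else 1))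
      where
      lemma : ∀ c → + 0 - c + c * (+ 1 - + 0) ≡ + 0
      lemma = solve-∀

  step₂-topLeft : ∀ {R J} → R < v → J < v → M₁ R J + ∑[ p < n ] (w₂ R (toℕ p) * M₁ (toℕ p) J) ≡ M₂ R J
  step₂-topLeft {R} {J} R<v J<v = trans (cong (_+_ (M₁ R J)) (∑-single (λ P → w₂ R P * M₁ P J) (v ℕ.+ J) v+J<n noTerm)) combined
    where
    v+J<n : v ℕ.+ J < n
    v+J<n = ℕ.+-monoʳ-< v (ℕ.<-≤-trans J<v (ℕ.m≤m+n v 0))
    noTerm : ∀ Q → Q < n → Q ≢ v ℕ.+ J → w₂ R Q * M₁ Q J ≡ + 0
    noTerm Q Q<n Q≢v+J with half Q Q<n
    ... | top Q<v rewrite isTop-top R<v | isTop-top Q<v = refl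
    ... | bottom K K<v refl rewrite isTop-bottom K | residue-bottom K | ≢⇒≡ᵇ≡false (top≢bottom K J<v)
        | ≢⇒≡ᵇ≡false (Q≢v+J ∘ cong (v ℕ.+_)) =
      ℤ.*-zeroʳ (if isTop R then + (if residue R ≡ᵇ K then v′ else 1) else + 0)
    combined : M₁ R J + w₂ R (v ℕ.+ J) * M₁ (v ℕ.+ J) J ≡ M₂ R J
    combined rewrite isTop-top R<v | isTop-top J<v | isTop-bottom J | residue-top R<v | residue-top J<v
      | residue-bottom J | ≡ᵇ-refl J | ≢⇒≡ᵇ≡false (top≢bottom J J<v) with R ≡ᵇ J
    ... | true  = lemma x (+ v′)
      where
      lemma : ∀ x q → x - q + q * (+ 0 - + 1) ≡ x - (q + q)
      lemma = solve-∀
    ... | false = refl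

  step₂ : ∀ R J → R < n → J < n → M₁ R J + ∑[ p < n ] (w₂ R (toℕ p) * M₁ (toℕ p) J) ≡ M₂ R J
  step₂ R J R<n J<n with half R R<n | half J J<n
  ... | bottom K _ refl | _                 = step₂-bottom K J
  ... | top R<v         | bottom L L<v refl = step₂-topRight L R<v L<v J<n
  ... | top R<v         | top J<v           = step₂-topLeft R<v J<v

  a : ℤ
  a = x - (q + q) + + 2

  -- Step 3: subtract the top row 0 from the other top rows, and take out the factor a.
  w₃ : ℕ → ℕ → ℤ
  w₃ R P = if R ≡ᵇ 0 then + 0 else (if isTop R then (if P ≡ᵇ 0 then - + 1 else + 0) else + 0)

  s₃ : ℕ → ℤ
  s₃ R = if R ≡ᵇ 0 then + 1 else (if isTop R then a else + 1)

  M₃ : ℕ → ℕ → ℤ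
  M₃ I J = if I ≡ᵇ 0 then M₂ I J else (if isTop I then (if isTop J then indicator (I ≡ᵇ J) - indicator (J ≡ᵇ 0) else + 0) else M₂ I J)

  step₃ : ∀ R J → R < n → J < n → M₂ R J + ∑[ p < n ] (w₃ R (toℕ p) * M₂ (toℕ p) J) ≡ s₃ R * M₃ R J
  step₃ zero J _ _ = trans (cong (_+_ (M₂ 0 J)) (∑-zero {n} λ _ → refl)) (trans (ℤ.+-identityʳ _) (sym (ℤ.*-identityˡ _)))
  step₃ (suc R) J R<n J<n with half (suc R) R<n
  ... | bottom K K<v eq = trans (cong (_+_ (M₂ (suc R) J)) (∑-zero {n} λ p → noTerm (toℕ p))) (trans (ℤ.+-identityʳ _) unchanged)
    where
    noTerm : ∀ Q → w₃ (suc R) Q * M₂ Q J ≡ + 0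
    noTerm Q rewrite eq | isTop-bottom K = refl
    unchanged : M₂ (suc R) J ≡ s₃ (suc R) * M₃ (suc R) J
    unchanged rewrite eq | isTop-bottom K = sym (ℤ.*-identityˡ _)
  ... | top R<v = trans (cong (_+_ (M₂ (suc R) J)) (∑-single (λ P → w₃ (suc R) P * M₂ P J) 0 (ℕ.<-≤-trans z<s R<n) noTerm)) (subtracted J J<n)
    where
    noTerm : ∀ Q → Q < n → Q ≢ 0 → w₃ (suc R) Q * M₂ Q J ≡ + 0
    noTerm zero    _ Q≢0 = ⊥-elim (Q≢0 refl)
    noTerm (suc Q) _ _   rewrite isTop-top R<v = refl
    subtracted : ∀ J → J < n → M₂ (suc R) J + w₃ (suc R) 0 * M₂ 0 J ≡ s₃ (suc R) * M₃ (suc R) J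
    subtracted J J<n with half J J<n
    ... | bottom L L<v refl rewrite isTop-top R<v | isTop-top {0} z<s | isTop-bottom L = sym (ℤ.*-zeroʳ a)
    subtracted zero J<n | top J<v rewrite isTop-top R<v | isTop-top {0} z<s = lemma x q
      where
      lemma : ∀ x q → - + 2 + - + 1 * (x - (q + q)) ≡ (x - (q + q) + + 2) * (+ 0 - + 1)
      lemma = solve-∀
    subtracted (suc J′) J<n | top J<v rewrite isTop-top R<v | isTop-top {0} z<s | isTop-top J<v with R ≡ᵇ J′
    ... | true  = lemma x q
      where
      lemma : ∀ x q → x - (q + q) + - + 1 * - + 2 ≡ (x - (q + q) + + 2) * (+ 1 - + 0)
      lemma = solve-∀
    ... | false = sym (ℤ.*-zeroʳ a)

  -- Step 4: add twice every other top row to the top row 0, which leaves a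
  -- lower triangular matrix.
  w₄ : ℕ → ℤ
  w₄ P = if P ≡ᵇ 0 then + 0 else (if isTop P then + 2 else + 0)

  M₄ : ℕ → ℕ → ℤ
  M₄ I J = if I ≡ᵇ 0 then (if J ≡ᵇ 0 then x - (q + q + q + q) else + 0) else M₃ I J

  step₄ : ∀ J → J < n → M₄ 0 J ≡ M₃ 0 J + ∑[ p < n ] (w₄ (toℕ p) * M₃ (toℕ p) J)
  step₄ zero _ = begin
    x - (q + q + q + q)
      ≡⟨ lemma x q ⟩
    x - (q + q) + (+ 0 + + v′ * - + 2)
      ≡⟨ cong₂ (λ d s → d + (+ 0 + s)) (sym diagonal) (sym otherRows) ⟩
    M₃ 0 0 + (+ 0 + ∑[ p < m ] (w₄ (suc (toℕ p)) * M₃ (suc (toℕ p)) 0))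
      ≡⟨ cong (λ t → M₃ 0 0 + (t + ∑[ p < m ] (w₄ (suc (toℕ p)) * M₃ (suc (toℕ p)) 0))) (sym (ℤ.*-zeroˡ (M₃ 0 0))) ⟩
    M₃ 0 0 + ∑[ p < n ] (w₄ (toℕ p) * M₃ (toℕ p) 0) ∎
    where
    open ≡-Reasoning
    m = v′ ℕ.+ suc (v′ ℕ.+ 0)
    lemma : ∀ x q → x - (q + q + q + q) ≡ x - (q + q) + (+ 0 + q * - + 2)
    lemma = solve-∀
    diagonal : M₃ 0 0 ≡ x - (q + q)
    diagonal rewrite isTop-top {0} z<s = refl
    term : ∀ (p : Fin m) → w₄ (suc (toℕ p)) * M₃ (suc (toℕ p)) 0 ≡ (if toℕ p <ᵇ v′ then - + 2 else + 0)
    term p rewrite isTop-suc (toℕ p) | isTop-top {0} z<s with toℕ p <ᵇ v′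
    ... | true  = refl
    ... | false = refl
    otherRows : ∑[ p < m ] (w₄ (suc (toℕ p)) * M₃ (suc (toℕ p)) 0) ≡ + v′ * - + 2
    otherRows = trans (sum-cong-≗ term) (∑-initialSegment {m} (- + 2) v′ (ℕ.m≤m+n v′ _))
  step₄ (suc J) J<n with half (suc J) J<n
  ... | bottom L L<v eq = trans (sym (ℤ.+-identityʳ _)) (cong₂ _+_ zeroEntry (sym (∑-zero {n} λ p → noTerm (toℕ p))))
    where
    zeroEntry : + 0 ≡ M₃ 0 (suc J)
    zeroEntry rewrite eq | isTop-top {0} z<s | isTop-bottom L = refl
    noTerm : ∀ Q → w₄ Q * M₃ Q (suc J) ≡ + 0
    noTerm zero    = refl
    noTerm (suc Q) rewrite eq | isTop-bottom L with isTop (suc Q)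
    ... | true  = refl
    ... | false = refl
  ... | top J<v = sym (trans (cong (_+_ (M₃ 0 (suc J))) (∑-single (λ P → w₄ P * M₃ P (suc J)) (suc J) J<n noTerm)) cancelled)
    where
    noTerm : ∀ Q → Q < n → Q ≢ suc J → w₄ Q * M₃ Q (suc J) ≡ + 0
    noTerm zero    _ _   = refl
    noTerm (suc Q) _ Q≢J rewrite isTop-top J<v | ≢⇒≡ᵇ≡false (Q≢J ∘ cong suc) with isTop (suc Q)
    ... | true  = refl
    ... | false = refl
    cancelled : M₃ 0 (suc J) + w₄ (suc J) * M₃ (suc J) (suc J) ≡ + 0
    cancelled rewrite isTop-top {0} z<s | isTop-top J<v | ≡ᵇ-refl J = refl

  M₄-lower : ∀ I J → I < n → J < n → I < J → M₄ I J ≡ + 0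
  M₄-lower zero    (suc J) _ _ _ = refl
  M₄-lower (suc I) J I<n J<n I<J with half (suc I) I<n | half J J<n
  M₄-lower (suc I) (suc J′) I<n J<n I<J | top I<v | top J<v
    rewrite isTop-top I<v | isTop-top J<v | ≢⇒≡ᵇ≡false {I} {J′} (λ eq → ℕ.<-irrefl (cong suc eq) I<J) = refl
  M₄-lower (suc I) J I<n J<n I<J | top I<v | bottom L L<v eq rewrite isTop-top I<v | eq | isTop-bottom L = refl
  M₄-lower (suc I) J I<n J<n I<J | bottom K K<v eq | _ rewrite eq | isTop-bottom K | residue-bottom K
    | ≢⇒≡ᵇ≡false {v ℕ.+ K} {J} (λ eq′ → ℕ.<-irrefl eq′ I<J)
    | ≢⇒≡ᵇ≡false {K} {J} (λ eq′ → ℕ.<-irrefl eq′ (ℕ.<-≤-trans K<v (ℕ.≤-trans (ℕ.m≤m+n v K) (ℕ.<⇒≤ I<J)))) = refl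

  M₄-diagonal : ∀ I → suc I < n → M₄ (suc I) (suc I) ≡ + 1
  M₄-diagonal I I<n with half (suc I) I<n
  ... | top I<v rewrite isTop-top I<v | ≡ᵇ-refl I = refl
  ... | bottom K K<v eq rewrite ≡ᵇ-refl I | eq | isTop-bottom K | residue-bottom K | ≢⇒≡ᵇ≡false {K} {v ℕ.+ K} (top≢bottom K K<v ∘ sym) = refl

  residue<n : ∀ I → I < n → isTop (residue I) ≡ true
  residue<n I I<n = isTop-top (residue<v I I<n)

  det-step₁ : det n (toMatrix M₀) ≡ ∏ {n} (s₁ ∘ toℕ) * det n (toMatrix M₁)
  det-step₁ = begin
    det n (toMatrix M₀)
      ≡⟨ sym (det-addCombinations (toMatrix M₀) (λ r p → w₁ (toℕ r) (toℕ p)) sources) ⟩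
    det n (λ r j → M₀ (toℕ r) (toℕ j) + ∑[ p < n ] (w₁ (toℕ r) (toℕ p) * M₀ (toℕ p) (toℕ j)))
      ≡⟨ det-scaleRows n _ (toMatrix M₁) (s₁ ∘ toℕ) (λ r j → step₁ (toℕ r) (toℕ j) (toℕ<n r)) ⟩
    ∏ {n} (s₁ ∘ toℕ) * det n (toMatrix M₁) ∎
    where
    open ≡-Reasoning
    w₁-top : ∀ P Q → isTop P ≡ true → w₁ P Q ≡ + 0
    w₁-top P Q isTopP rewrite isTopP = refl
    sources : ∀ (r p : Fin n) → w₁ (toℕ r) (toℕ p) ≡ + 0 ⊎ (∀ (t : Fin n) → w₁ (toℕ p) (toℕ t) ≡ + 0)
    sources r p with isTop (toℕ r) in isTopR
    ... | true  = inj₁ refl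
    ... | false with toℕ p ≡ᵇ residue (toℕ r) in p≡residue
    ...   | false = inj₁ refl
    ...   | true  = inj₂ λ t → w₁-top (toℕ p) (toℕ t)
                      (subst (λ P → isTop P ≡ true) (sym (≡ᵇ≡true⇒≡ p≡residue)) (residue<n (toℕ r) (toℕ<n r)))

  det-step₂ : det n (toMatrix M₁) ≡ det n (toMatrix M₂)
  det-step₂ = trans (sym (det-addCombinations (toMatrix M₁) (λ r p → w₂ (toℕ r) (toℕ p)) sources))
                    (det-cong n λ r j → step₂ (toℕ r) (toℕ j) (toℕ<n r) (toℕ<n j))
    where
    sources : ∀ (r p : Fin n) → w₂ (toℕ r) (toℕ p) ≡ + 0 ⊎ (∀ (t : Fin n) → w₂ (toℕ p) (toℕ t) ≡ + 0)
    sources r p with isTop (toℕ r)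
    ... | false = inj₁ refl
    ... | true with isTop (toℕ p)
    ...   | true  = inj₁ refl
    ...   | false = inj₂ λ t → refl

  det-step₃ : det n (toMatrix M₂) ≡ ∏ {n} (s₃ ∘ toℕ) * det n (toMatrix M₃)
  det-step₃ = trans (sym (det-addCombinations (toMatrix M₂) (λ r p → w₃ (toℕ r) (toℕ p)) sources))
                    (det-scaleRows n _ (toMatrix M₃) (s₃ ∘ toℕ) λ r j → step₃ (toℕ r) (toℕ j) (toℕ<n r) (toℕ<n j))
    where
    sources : ∀ (r p : Fin n) → w₃ (toℕ r) (toℕ p) ≡ + 0 ⊎ (∀ (t : Fin n) → w₃ (toℕ p) (toℕ t) ≡ + 0)
    sources r p with toℕ r ≡ᵇ 0
    ... | true = inj₁ refl
    ... | false with isTop (toℕ r)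
    ...   | false = inj₁ refl
    ...   | true with toℕ p ≡ᵇ 0
    ...     | false = inj₁ refl
    ...     | true  = inj₂ λ t → refl

  det-step₄ : det n (toMatrix M₃) ≡ x - (q + q + q + q)
  det-step₄ = begin
    det n (toMatrix M₃)
      ≡⟨ sym (det-addCombination n (toMatrix M₃) (toMatrix M₄) zero (w₄ ∘ toℕ) refl (λ j → step₄ (toℕ j) (toℕ<n j)) otherRows) ⟩
    det n (toMatrix M₄)
      ≡⟨ det-lowerTriangular n (toMatrix M₄) (λ i j → M₄-lower (toℕ i) (toℕ j) (toℕ<n i) (toℕ<n j)) ⟩
    (x - (q + q + q + q)) * ∏ {m} (λ i → M₄ (suc (toℕ i)) (suc (toℕ i)))
      ≡⟨ cong ((x - (q + q + q + q)) *_) (∏-ones {m} λ i → M₄-diagonal (toℕ i) (toℕ<n (suc i))) ⟩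
    (x - (q + q + q + q)) * + 1
      ≡⟨ ℤ.*-identityʳ _ ⟩
    x - (q + q + q + q) ∎
    where
    open ≡-Reasoning
    m = v′ ℕ.+ suc (v′ ℕ.+ 0)
    otherRows : ∀ i → i ≢ zero → ∀ j → toMatrix M₄ i j ≡ toMatrix M₃ i j
    otherRows zero    i≢0 j = ⊥-elim (i≢0 refl)
    otherRows (suc i) _   j = refl

  ∏-s₁ : ∏ {n} (s₁ ∘ toℕ) ≡ x ^ v
  ∏-s₁ = begin
    ∏ {n} (s₁ ∘ toℕ)
      ≡⟨ ∏-cong {n} (λ r → cong (λ b → if b then + 1 else x) (isTop-≡ (toℕ r))) ⟩
    ∏ {n} (λ r → if toℕ r <ᵇ v then + 1 else x)
      ≡⟨ ∏-initialSegment {n} (+ 1) x v (ℕ.m≤m+n v _) ⟩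
    (+ 1) ^ v * x ^ (n ∸ v)
      ≡⟨ cong₂ _*_ (ℤ.^-zeroˡ v) (cong (x ^_) (trans (ℕ.m+n∸m≡n v (v ℕ.+ 0)) (ℕ.+-identityʳ v))) ⟩
    + 1 * x ^ v
      ≡⟨ ℤ.*-identityˡ _ ⟩
    x ^ v ∎
    where open ≡-Reasoning

  ∏-s₃ : ∏ {n} (s₃ ∘ toℕ) ≡ a ^ v′
  ∏-s₃ = begin
    + 1 * ∏ {m} (λ r → s₃ (suc (toℕ r)))
      ≡⟨ ℤ.*-identityˡ _ ⟩
    ∏ {m} (λ r → s₃ (suc (toℕ r)))
      ≡⟨ ∏-cong {m} (λ r → cong (λ b → if b then a else + 1) (isTop-suc (toℕ r))) ⟩
    ∏ {m} (λ r → if toℕ r <ᵇ v′ then a else + 1)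
      ≡⟨ ∏-initialSegment {m} a (+ 1) v′ (ℕ.m≤m+n v′ _) ⟩
    a ^ v′ * (+ 1) ^ (m ∸ v′)
      ≡⟨ cong (a ^ v′ *_) (ℤ.^-zeroˡ (m ∸ v′)) ⟩
    a ^ v′ * + 1
      ≡⟨ ℤ.*-identityʳ _ ⟩
    a ^ v′ ∎
    where
    open ≡-Reasoning
    m = v′ ℕ.+ suc (v′ ℕ.+ 0)

  det-M₀ : det n (toMatrix M₀) ≡ x ^ v * (a ^ v′ * (x - (q + q + q + q)))
  det-M₀ = begin
    det n (toMatrix M₀)                                         ≡⟨ det-step₁ ⟩
    ∏ {n} (s₁ ∘ toℕ) * det n (toMatrix M₁)                          ≡⟨ cong₂ _*_ ∏-s₁ (trans det-step₂ det-step₃) ⟩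
    x ^ v * (∏ {n} (s₃ ∘ toℕ) * det n (toMatrix M₃))                ≡⟨ cong (x ^ v *_) (cong₂ _*_ ∏-s₃ det-step₄) ⟩
    x ^ v * (a ^ v′ * (x - (q + q + q + q))) ∎
    where open ≡-Reasoning

module CharacteristicPolynomial where
  open import Data.Nat as ℕ using (ℕ; suc; _≤_; _∸_; s≤s; z≤n)
  import Data.Nat.Properties as ℕ
  open import Data.Nat.Tactic.RingSolver renaming (solve-∀ to ℕ-solve-∀)
  open import Data.Integer as ℤ using (ℤ; +_; _+_; _*_; _-_; _^_)
  import Data.Integer.Properties as ℤ
  open import Data.Integer.Tactic.RingSolver using (solve-∀)
  open import Data.Fin as Fin using (Fin; toℕ)
  open import Data.Fin.Properties using (toℕ-injective)
  open import Function using (_∘_)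
  open import Relation.Nullary using (yes; no)
  open import Relation.Nullary.Decidable using (⌊_⌋)
  open import Relation.Binary.PropositionalEquality
  open Determinant using (det-cong)

  ⌊≟⌋≡toℕ-≡ᵇ : ∀ {m} (i j : Fin m) → ⌊ i Fin.≟ j ⌋ ≡ (toℕ i ℕ.≡ᵇ toℕ j)
  ⌊≟⌋≡toℕ-≡ᵇ i j with i Fin.≟ j
  ... | yes refl = sym (≡ᵇ-refl (toℕ i))
  ... | no  i≢j  = sym (≢⇒≡ᵇ≡false (i≢j ∘ toℕ-injective))

  charMat-circulant : ∀ v′ x (i j : Fin (2 ℕ.* suc v′)) →
    charMat x (circulant (2 ℕ.* suc v′) (firstRow (suc v′))) i j ≡ CharacteristicMatrix.toMatrix v′ x (CharacteristicMatrix.M₀ v′ x) i j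
  charMat-circulant v′ x i j rewrite ⌊≟⌋≡toℕ-≡ᵇ i j | CirculantPattern.circulant-firstRow v′ i j = refl

  2*[3+u]∸4≡2+[u+u] : ∀ u → 2 ℕ.* (3 ℕ.+ u) ∸ 4 ≡ 2 ℕ.+ (u ℕ.+ u)
  2*[3+u]∸4≡2+[u+u] u = trans (cong (_∸ 4) (double u)) (ℕ.m+n∸m≡n 4 (2 ℕ.+ (u ℕ.+ u)))
    where
    double : ∀ u → 2 ℕ.* (3 ℕ.+ u) ≡ 4 ℕ.+ (2 ℕ.+ (u ℕ.+ u))
    double = ℕ-solve-∀

  x-[q+q]+2≡x-[2v∸4] : ∀ u x → x - (+ (2 ℕ.+ u) + + (2 ℕ.+ u)) + + 2 ≡ x - + (2 ℕ.* (3 ℕ.+ u) ∸ 4)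
  x-[q+q]+2≡x-[2v∸4] u x rewrite 2*[3+u]∸4≡2+[u+u] u | ℤ.pos-+ 2 (u ℕ.+ u) | ℤ.pos-+ u u = lemma x (+ u)
    where
    lemma : ∀ x u → x - ((+ 2 + u) + (+ 2 + u)) + + 2 ≡ x - (+ 2 + (u + u))
    lemma = solve-∀

  x-4q≡x-4[v∸1] : ∀ v′ x → x - (+ v′ + + v′ + + v′ + + v′) ≡ x - + (4 ℕ.* v′)
  x-4q≡x-4[v∸1] v′ x rewrite ℤ.pos-* 4 v′ = lemma x (+ v′)
    where
    lemma : ∀ x q → x - (q + q + q + q) ≡ x - + 4 * q
    lemma = solve-∀

  charPoly-circulant : ∀ v → 3 ≤ v → ∀ (x : ℤ) → charPoly (2 ℕ.* v) (circulant (2 ℕ.* v) (firstRow v)) x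
    ≡ (x - + (4 ℕ.* (v ∸ 1))) * (x - + (2 ℕ.* v ∸ 4)) ^ (v ∸ 1) * x ^ v
  charPoly-circulant v@(suc v′@(suc (suc u))) (s≤s (s≤s (s≤s z≤n))) x = begin
    charPoly (2 ℕ.* v) (circulant (2 ℕ.* v) (firstRow v)) x
      ≡⟨ det-cong (2 ℕ.* v) (charMat-circulant v′ x) ⟩
    det (2 ℕ.* v) (toMatrix M₀)
      ≡⟨ det-M₀ ⟩
    x ^ v * (a ^ v′ * (x - (q + q + q + q)))
      ≡⟨ cong₂ (λ s t → x ^ v * (s ^ v′ * t)) (x-[q+q]+2≡x-[2v∸4] u x) (x-4q≡x-4[v∸1] v′ x) ⟩
    x ^ v * ((x - + (2 ℕ.* v ∸ 4)) ^ v′ * (x - + (4 ℕ.* v′)))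
      ≡⟨ reorder (x ^ v) ((x - + (2 ℕ.* v ∸ 4)) ^ v′) (x - + (4 ℕ.* v′)) ⟩
    (x - + (4 ℕ.* v′)) * (x - + (2 ℕ.* v ∸ 4)) ^ v′ * x ^ v ∎
    where
    open ≡-Reasoning
    open CharacteristicMatrix v′ x using (toMatrix; M₀; det-M₀; a; q)
    reorder : ∀ X A B → X * (A * B) ≡ B * A * X
    reorder = solve-∀

module CompleteGraph where
  open import Data.Nat
  open import Data.Nat.Properties
  open import Data.Nat.Combinatorics using (_C_; nC1≡n; nCk+nC[k+1]≡[n+1]C[k+1])
  open import Data.Bool using (Bool; true; false; _∨_)
  open import Data.Fin as Fin using (Fin; zero; suc; toℕ; cast; splitAt; _↑ˡ_; _↑ʳ_)
  open import Data.Fin.Properties using (toℕ<n; cast-is-id; splitAt-↑ˡ; splitAt-↑ʳ)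
  open import Data.Product as Product using (_×_; _,_; proj₁; proj₂)
  open import Data.Sum using (_⊎_; inj₁; inj₂)
  open import Data.Empty using (⊥-elim)
  open import Function using (_∘_)
  open import Relation.Binary.PropositionalEquality
  import Algebra.Properties.Semiring.Sum +-*-semiring as ℕΣ
  open ℕΣ using (sum-cong-≗)
  open SemiringSums +-*-semiring using (∑-zero; ∑-single)

  private variable m : ℕ

  sumℕ≡sum : (f : Fin m → ℕ) → sumℕ f ≡ ℕΣ.sum f
  sumℕ≡sum {zero}  f = refl
  sumℕ≡sum {suc m} f = cong (f zero +_) (sumℕ≡sum (f ∘ suc))

  ∑< : ∀ m → (ℕ → ℕ) → ℕ
  ∑< m g = ℕΣ.sum {m} (g ∘ toℕ)

  ∑<-cong : ∀ m {f g : ℕ → ℕ} → (∀ K → K < m → f K ≡ g K) → ∑< m f ≡ ∑< m g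
  ∑<-cong m f≡g = sum-cong-≗ λ i → f≡g (toℕ i) (toℕ<n i)

  ∑<-ones : ∀ m → ∑< m (λ _ → 1) ≡ m
  ∑<-ones zero    = refl
  ∑<-ones (suc m) = cong suc (∑<-ones m)

  ∑<-split : ∀ m k (g : ℕ → ℕ) → ∑< (m + k) g ≡ ∑< m g + ∑< k (λ K → g (m + K))
  ∑<-split zero    k g = refl
  ∑<-split (suc m) k g = trans (cong (g 0 +_) (∑<-split m k (g ∘ suc))) (sym (+-assoc (g 0) _ _))

  ∑-cast : ∀ {a b} (eq : a ≡ b) (g : Fin b → ℕ) → ℕΣ.sum {a} (g ∘ cast eq) ≡ ℕΣ.sum {b} g
  ∑-cast refl g = sum-cong-≗ λ B → cong g (cast-is-id refl B)

  ∑-splitAt : ∀ m k (g : Fin (m + k) → ℕ) → ℕΣ.sum g ≡ ℕΣ.sum (λ i → g (i ↑ˡ k)) + ℕΣ.sum (λ i → g (m ↑ʳ i))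
  ∑-splitAt zero    k g = refl
  ∑-splitAt (suc m) k g = trans (cong (g zero +_) (∑-splitAt m k (g ∘ suc))) (sym (+-assoc (g zero) _ _))

  ⟦⟧-idem : ∀ b → ⟦ b ⟧ * ⟦ b ⟧ ≡ ⟦ b ⟧
  ⟦⟧-idem true  = refl
  ⟦⟧-idem false = refl

  -- The pairs {a , b} with a < b < m, enumerated through m + 1 choose 2 = m + m choose 2:
  -- first the pairs containing 0, then the pairs of positive numbers.
  pascal : ∀ m → suc m C 2 ≡ m + m C 2
  pascal m = trans (sym (nCk+nC[k+1]≡[n+1]C[k+1] m 1)) (cong (_+ m C 2) (nC1≡n m))

  mutual
    pair : ∀ m → Fin (m C 2) → ℕ × ℕ
    pair zero    ()
    pair (suc m) B = pairFromSplit m (splitAt m (cast (pascal m) B))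

    pairFromSplit : ∀ m → Fin m ⊎ Fin (m C 2) → ℕ × ℕ
    pairFromSplit m (inj₁ k)  = 0 , suc (toℕ k)
    pairFromSplit m (inj₂ B′) = Product.map suc suc (pair m B′)

  pair-< : ∀ m B → proj₁ (pair m B) < proj₂ (pair m B) × proj₂ (pair m B) < m
  pair-< (suc m) B with splitAt m (cast (pascal m) B)
  ... | inj₁ k  = z<s , s≤s (toℕ<n k)
  ... | inj₂ B′ = Product.map s≤s s≤s (pair-< m B′)

  ∑-pairs-suc : ∀ m (f : ℕ × ℕ → ℕ) →
    ℕΣ.sum (f ∘ pair (suc m)) ≡ ∑< m (λ k → f (0 , suc k)) + ℕΣ.sum (λ B → f (Product.map suc suc (pair m B)))
  ∑-pairs-suc m f = begin
    ℕΣ.sum (f ∘ pair (suc m))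
      ≡⟨ ∑-cast (pascal m) (f ∘ pairFromSplit m ∘ splitAt m) ⟩
    ℕΣ.sum (f ∘ pairFromSplit m ∘ splitAt m)
      ≡⟨ ∑-splitAt m (m C 2) (f ∘ pairFromSplit m ∘ splitAt m) ⟩
    ℕΣ.sum (λ i → f (pairFromSplit m (splitAt m (i ↑ˡ m C 2)))) + ℕΣ.sum (λ i → f (pairFromSplit m (splitAt m (m ↑ʳ i))))
      ≡⟨ cong₂ _+_ (sum-cong-≗ λ i → cong (f ∘ pairFromSplit m) (splitAt-↑ˡ m i (m C 2)))
         (sum-cong-≗ λ i → cong (f ∘ pairFromSplit m) (splitAt-↑ʳ m (m C 2) i)) ⟩
    ∑< m (λ k → f (0 , suc k)) + ℕΣ.sum (λ B → f (Product.map suc suc (pair m B))) ∎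
    where open ≡-Reasoning

  _∈ᵇ_ : ℕ → ℕ × ℕ → Bool
  y ∈ᵇ (a , b) = (y ≡ᵇ a) ∨ (y ≡ᵇ b)

  ∑<-≡ᵇ : ∀ m y → y < m → ∑< m (λ k → ⟦ y ≡ᵇ k ⟧) ≡ 1
  ∑<-≡ᵇ m y y<m = trans (∑-single {m} (λ k → ⟦ y ≡ᵇ k ⟧) y y<m λ Q _ Q≢y → cong ⟦_⟧ (≢⇒≡ᵇ≡false (Q≢y ∘ sym)))
                       (cong ⟦_⟧ (≡ᵇ-refl y))

  pairsThrough : ∀ m y → y < m → ℕΣ.sum (λ B → ⟦ y ∈ᵇ pair m B ⟧) ≡ m ∸ 1
  pairsThrough (suc m) zero    _ = begin
    ℕΣ.sum (λ B → ⟦ 0 ∈ᵇ pair (suc m) B ⟧)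
      ≡⟨ ∑-pairs-suc m (λ p → ⟦ 0 ∈ᵇ p ⟧) ⟩
    ∑< m (λ _ → 1) + ℕΣ.sum (λ B → ⟦ 0 ∈ᵇ Product.map suc suc (pair m B) ⟧)
      ≡⟨ cong₂ _+_ (∑<-ones m) (ℕΣ.sum-replicate-zero (m C 2)) ⟩
    m + 0
      ≡⟨ +-identityʳ m ⟩
    m ∎
    where open ≡-Reasoning
  pairsThrough (suc m) (suc y) (s≤s y<m) = begin
    ℕΣ.sum (λ B → ⟦ suc y ∈ᵇ pair (suc m) B ⟧)
      ≡⟨ ∑-pairs-suc m (λ p → ⟦ suc y ∈ᵇ p ⟧) ⟩
    ∑< m (λ k → ⟦ y ≡ᵇ k ⟧) + ℕΣ.sum (λ B → ⟦ y ∈ᵇ pair m B ⟧) ≡⟨ cong₂ _+_ (∑<-≡ᵇ m y y<m) (pairsThrough m y y<m) ⟩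
    1 + (m ∸ 1)
      ≡⟨ m+[n∸m]≡n (≤-<-trans z≤n y<m) ⟩
    m ∎
    where open ≡-Reasoning

  pairsThrough₂ : ∀ m y z → y < m → z < m → y ≢ z → ℕΣ.sum (λ B → ⟦ y ∈ᵇ pair m B ⟧ * ⟦ z ∈ᵇ pair m B ⟧) ≡ 1
  pairsThrough₂ (suc m) zero    zero    _         _         y≢z = ⊥-elim (y≢z refl)
  pairsThrough₂ (suc m) zero    (suc z) _         (s≤s z<m) _   = begin
    ℕΣ.sum (λ B → ⟦ 0 ∈ᵇ pair (suc m) B ⟧ * ⟦ suc z ∈ᵇ pair (suc m) B ⟧)
      ≡⟨ ∑-pairs-suc m (λ p → ⟦ 0 ∈ᵇ p ⟧ * ⟦ suc z ∈ᵇ p ⟧) ⟩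
    ∑< m (λ k → ⟦ z ≡ᵇ k ⟧ + 0) + ℕΣ.sum {m C 2} (λ _ → 0)
      ≡⟨ cong₂ _+_ (trans (∑<-cong m λ K _ → +-identityʳ ⟦ z ≡ᵇ K ⟧) (∑<-≡ᵇ m z z<m)) (ℕΣ.sum-replicate-zero (m C 2)) ⟩
    1 ∎
    where open ≡-Reasoning
  pairsThrough₂ (suc m) (suc y) zero    (s≤s y<m) _         _   = begin
    ℕΣ.sum (λ B → ⟦ suc y ∈ᵇ pair (suc m) B ⟧ * ⟦ 0 ∈ᵇ pair (suc m) B ⟧)
      ≡⟨ ∑-pairs-suc m (λ p → ⟦ suc y ∈ᵇ p ⟧ * ⟦ 0 ∈ᵇ p ⟧) ⟩
    ∑< m (λ k → ⟦ y ≡ᵇ k ⟧ * 1) + ℕΣ.sum (λ B → ⟦ y ∈ᵇ pair m B ⟧ * 0)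
      ≡⟨ cong₂ _+_ (trans (∑<-cong m λ K _ → *-identityʳ ⟦ y ≡ᵇ K ⟧) (∑<-≡ᵇ m y y<m))
                   (trans (sum-cong-≗ {m C 2} λ B → *-zeroʳ ⟦ y ∈ᵇ pair m B ⟧) (ℕΣ.sum-replicate-zero (m C 2))) ⟩
    1 ∎
    where open ≡-Reasoning
  pairsThrough₂ (suc m) (suc y) (suc z) (s≤s y<m) (s≤s z<m) y≢z = begin
    ℕΣ.sum (λ B → ⟦ suc y ∈ᵇ pair (suc m) B ⟧ * ⟦ suc z ∈ᵇ pair (suc m) B ⟧)
      ≡⟨ ∑-pairs-suc m (λ p → ⟦ suc y ∈ᵇ p ⟧ * ⟦ suc z ∈ᵇ p ⟧) ⟩
    ∑< m (λ k → ⟦ y ≡ᵇ k ⟧ * ⟦ z ≡ᵇ k ⟧) + ℕΣ.sum (λ B → ⟦ y ∈ᵇ pair m B ⟧ * ⟦ z ∈ᵇ pair m B ⟧)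
      ≡⟨ cong₂ _+_ (∑-zero {m} λ i → notBoth (toℕ i)) (pairsThrough₂ m y z y<m z<m (y≢z ∘ cong suc)) ⟩
    1 ∎
    where
    open ≡-Reasoning
    notBoth : ∀ k → ⟦ y ≡ᵇ k ⟧ * ⟦ z ≡ᵇ k ⟧ ≡ 0
    notBoth k with y ≡ᵇ k in y≡ᵇk | z ≡ᵇ k in z≡ᵇk
    ... | false | _     = refl
    ... | true  | false = refl
    ... | true  | true  = ⊥-elim (y≢z (cong suc (trans (≡ᵇ≡true⇒≡ {y} {k} y≡ᵇk) (sym (≡ᵇ≡true⇒≡ {z} {k} z≡ᵇk)))))

  ∑<-∈ᵇ : ∀ m (h : ℕ → ℕ) a b → a < m → b < m → a ≢ b → ∑< m (λ Z → h Z * ⟦ Z ∈ᵇ (a , b) ⟧) ≡ h a + h b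
  ∑<-∈ᵇ m h a b a<m b<m a≢b = begin
    ∑< m (λ Z → h Z * ⟦ Z ∈ᵇ (a , b) ⟧)
      ≡⟨ ∑<-cong m (λ Z _ → split Z) ⟩
    ∑< m (λ Z → h Z * ⟦ Z ≡ᵇ a ⟧ + h Z * ⟦ Z ≡ᵇ b ⟧)
      ≡⟨ ℕΣ.∑-distrib-+ {m} (λ i → h (toℕ i) * ⟦ toℕ i ≡ᵇ a ⟧) (λ i → h (toℕ i) * ⟦ toℕ i ≡ᵇ b ⟧) ⟩
    ∑< m (λ Z → h Z * ⟦ Z ≡ᵇ a ⟧) + ∑< m (λ Z → h Z * ⟦ Z ≡ᵇ b ⟧) ≡⟨ cong₂ _+_ (single a a<m) (single b b<m) ⟩
    h a + h b ∎
    where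
    open ≡-Reasoning
    split : ∀ Z → h Z * ⟦ Z ∈ᵇ (a , b) ⟧ ≡ h Z * ⟦ Z ≡ᵇ a ⟧ + h Z * ⟦ Z ≡ᵇ b ⟧
    split Z with Z ≡ᵇ a in Z≡ᵇa | Z ≡ᵇ b in Z≡ᵇb
    ... | true  | true  = ⊥-elim (a≢b (trans (sym (≡ᵇ≡true⇒≡ {Z} {a} Z≡ᵇa)) (≡ᵇ≡true⇒≡ {Z} {b} Z≡ᵇb)))
    ... | true  | false = sym (trans (cong (h Z * 1 +_) (*-zeroʳ (h Z))) (+-identityʳ _))
    ... | false | true  = sym (cong (_+ h Z * 1) (*-zeroʳ (h Z)))
    ... | false | false = sym (cong (_+ h Z * 0) (*-zeroʳ (h Z)))
    single : ∀ c → c < m → ∑< m (λ Z → h Z * ⟦ Z ≡ᵇ c ⟧) ≡ h c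
    single c c<m = trans (∑-single {m} (λ Z → h Z * ⟦ Z ≡ᵇ c ⟧) c c<m λ Q _ Q≢c → trans (cong (λ t → h Q * ⟦ t ⟧) (≢⇒≡ᵇ≡false Q≢c)) (*-zeroʳ (h Q)))
                         (trans (cong (λ t → h c * ⟦ t ⟧) (≡ᵇ-refl c)) (*-identityʳ (h c)))

module DoubledCompleteGraph (v′ : ℕ) where
  open import Data.Nat
  open import Data.Nat.Properties
  open import Data.Nat.Combinatorics using (_C_)
  open import Data.Nat.Tactic.RingSolver using (solve-∀)
  open import Data.Bool using (true; false; if_then_else_)
  open import Data.Fin using (Fin; toℕ)
  open import Data.Fin.Properties using (toℕ<n)
  open import Data.Product using (proj₁; proj₂; _,_)
  open import Data.Empty using (⊥-elim)
  open import Function using (_∘_)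
  open import Relation.Binary.PropositionalEquality
  import Algebra.Properties.Semiring.Sum +-*-semiring as ℕΣ
  open ℕΣ using (sum-cong-≗)
  open CompleteGraph
  open Halves v′

  n : ℕ
  n = 2 * v

  ρ : Fin n → ℕ
  ρ p = residue (toℕ p)

  ρ<v : ∀ p → ρ p < v
  ρ<v p = residue<v (toℕ p) (toℕ<n p)

  N : Incidence n (v C 2)
  N p B = ρ p ∈ᵇ pair v B

  commonBlocks : ℕ → ℕ → ℕ
  commonBlocks Y Z = if Y ≡ᵇ Z then v ∸ 1 else 1

  -- every residue class has exactly two points
  ∑-ρ : ∀ (h : ℕ → ℕ) → ℕΣ.sum {n} (h ∘ ρ) ≡ ∑< v h + ∑< v h
  ∑-ρ h = trans (∑<-split v (v + 0) (h ∘ residue))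
    (cong₂ _+_ (∑<-cong v λ K K<v → cong h (residue-top K<v))
               (trans (∑<-cong (v + 0) λ K _ → cong h (residue-bottom K)) (cong (λ t → ∑< t h) (+-identityʳ v))))

  ∑-commonBlocks : ∀ Y Z → Y < v → Z < v → ℕΣ.sum (λ B → ⟦ Y ∈ᵇ pair v B ⟧ * ⟦ Z ∈ᵇ pair v B ⟧) ≡ commonBlocks Y Z
  ∑-commonBlocks Y Z Y<v Z<v with Y ≡ᵇ Z in Y≡ᵇZ
  ... | true  rewrite ≡ᵇ≡true⇒≡ {Y} {Z} Y≡ᵇZ =
    trans (sum-cong-≗ {v C 2} λ B → ⟦⟧-idem (Z ∈ᵇ pair v B)) (pairsThrough v Z Z<v)
  ... | false = pairsThrough₂ v Y Z Y<v Z<v (≡ᵇ≡false⇒≢ Y≡ᵇZ)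

  N-concurrence : ∀ i j → concurrence N i j ≡ commonBlocks (ρ i) (ρ j)
  N-concurrence i j = trans (sumℕ≡sum λ A → ⟦ N i A ⟧ * ⟦ N j A ⟧) (∑-commonBlocks (ρ i) (ρ j) (ρ<v i) (ρ<v j))

  N-blockSize : ∀ B → sumℕ (λ p → ⟦ N p B ⟧) ≡ 4
  N-blockSize B = begin
    sumℕ (λ p → ⟦ N p B ⟧)                           ≡⟨ sumℕ≡sum (λ p → ⟦ N p B ⟧) ⟩
    ℕΣ.sum (λ p → ⟦ N p B ⟧)                         ≡⟨ ∑-ρ (λ Z → ⟦ Z ∈ᵇ pair v B ⟧) ⟩
    ∑< v (λ Z → ⟦ Z ∈ᵇ pair v B ⟧) + ∑< v (λ Z → ⟦ Z ∈ᵇ pair v B ⟧)  ≡⟨ cong₂ _+_ two two ⟩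
    4 ∎
    where
    open ≡-Reasoning
    a<b = proj₁ (pair-< v B)
    b<v = proj₂ (pair-< v B)
    two : ∑< v (λ Z → ⟦ Z ∈ᵇ pair v B ⟧) ≡ 2
    two = trans (∑<-cong v λ Z _ → sym (*-identityˡ ⟦ Z ∈ᵇ pair v B ⟧))
                (∑<-∈ᵇ v (λ _ → 1) _ _ (<-trans a<b b<v) b<v (<⇒≢ a<b))

  N-replication : ∀ p → sumℕ (λ B → ⟦ N p B ⟧) ≡ v ∸ 1
  N-replication p = trans (sumℕ≡sum λ B → ⟦ N p B ⟧) (pairsThrough v (ρ p) (ρ<v p))

  pgd-arithmetic : ∀ Y a b → a ≢ b →
    commonBlocks Y a + commonBlocks Y b + (commonBlocks Y a + commonBlocks Y b) ≡ 2 * v * ⟦ Y ∈ᵇ (a , b) ⟧ + 4 * (1 ∸ ⟦ Y ∈ᵇ (a , b) ⟧)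
  pgd-arithmetic Y a b a≢b with Y ≡ᵇ a in Y≡ᵇa | Y ≡ᵇ b in Y≡ᵇb
  ... | true  | true  = ⊥-elim (a≢b (trans (sym (≡ᵇ≡true⇒≡ {Y} {a} Y≡ᵇa)) (≡ᵇ≡true⇒≡ {Y} {b} Y≡ᵇb)))
  ... | true  | false = lemma v′
    where lemma : ∀ w → w + 1 + (w + 1) ≡ 2 * suc w * 1 + 4 * 0
          lemma = solve-∀
  ... | false | true  = lemma v′
    where lemma : ∀ w → 1 + w + (1 + w) ≡ 2 * suc w * 1 + 4 * 0
          lemma = solve-∀
  ... | false | false = lemma v′
    where lemma : ∀ w → 1 + 1 + (1 + 1) ≡ 2 * suc w * 0 + 4 * 1
          lemma = solve-∀

  N-NNᵀN : ∀ a B → NNᵀN N a B ≡ 2 * v * ⟦ N a B ⟧ + 4 * (1 ∸ ⟦ N a B ⟧)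
  N-NNᵀN a B = begin
    NNᵀN N a B
      ≡⟨ trans (sumℕ≡sum λ A → sumℕ λ x → ⟦ N a A ⟧ * ⟦ N x A ⟧ * ⟦ N x B ⟧)
         (sum-cong-≗ λ A → sumℕ≡sum λ x → ⟦ N a A ⟧ * ⟦ N x A ⟧ * ⟦ N x B ⟧) ⟩
    ℕΣ.sum (λ A → ℕΣ.sum (λ x → ⟦ N a A ⟧ * ⟦ N x A ⟧ * ⟦ N x B ⟧))
      ≡⟨ ℕΣ.∑-comm (λ A x → ⟦ N a A ⟧ * ⟦ N x A ⟧ * ⟦ N x B ⟧) ⟩
    ℕΣ.sum (λ x → ℕΣ.sum (λ A → ⟦ N a A ⟧ * ⟦ N x A ⟧ * ⟦ N x B ⟧))
      ≡⟨ sum-cong-≗ (λ x → trans (sym (ℕΣ.*-distribʳ-sum ⟦ N x B ⟧ λ A → ⟦ N a A ⟧ * ⟦ N x A ⟧))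
         (cong (_* ⟦ N x B ⟧) (∑-commonBlocks (ρ a) (ρ x) (ρ<v a) (ρ<v x)))) ⟩
    ℕΣ.sum (λ x → commonBlocks (ρ a) (ρ x) * ⟦ ρ x ∈ᵇ pair v B ⟧)
      ≡⟨ ∑-ρ (λ Z → commonBlocks (ρ a) Z * ⟦ Z ∈ᵇ pair v B ⟧) ⟩
    ∑< v (λ Z → commonBlocks (ρ a) Z * ⟦ Z ∈ᵇ pair v B ⟧) + ∑< v (λ Z → commonBlocks (ρ a) Z * ⟦ Z ∈ᵇ pair v B ⟧)
      ≡⟨ cong₂ _+_ members members ⟩
    commonBlocks (ρ a) (proj₁ (pair v B)) + commonBlocks (ρ a) (proj₂ (pair v B)) + (commonBlocks (ρ a) (proj₁ (pair v B)) + commonBlocks (ρ a) (proj₂ (pair v B)))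
      ≡⟨ pgd-arithmetic (ρ a) (proj₁ (pair v B)) (proj₂ (pair v B)) (<⇒≢ a<b) ⟩
    2 * v * ⟦ N a B ⟧ + 4 * (1 ∸ ⟦ N a B ⟧) ∎
    where
    open ≡-Reasoning
    a<b = proj₁ (pair-< v B)
    b<v = proj₂ (pair-< v B)
    members : ∑< v (λ Z → commonBlocks (ρ a) Z * ⟦ Z ∈ᵇ pair v B ⟧) ≡ commonBlocks (ρ a) (proj₁ (pair v B)) + commonBlocks (ρ a) (proj₂ (pair v B))
    members = ∑<-∈ᵇ v (commonBlocks (ρ a)) _ _ (<-trans a<b b<v) b<v (<⇒≢ a<b)

open import Data.Nat using (_≤_; _*_; _∸_; suc)
open import Data.Nat.Combinatorics using (_C_)
open import Data.Integer as ℤ using (+_)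
open import Data.Fin.Permutation using (Permutation′; _⟨$⟩ʳ_)
import Data.Fin.Permutation as Permutation
open import Data.Product using (Σ-syntax; _×_; _,_)
open import Relation.Binary.PropositionalEquality using (_≡_; trans; sym)
open CharacteristicPolynomial using (charPoly-circulant)

mainTheorem2 : ∀ (v : ℕ) → 3 ≤ v →
    Σ[ N ∈ Incidence (2 * v) (v C 2) ]
      IsPGD N 4 (v ∸ 1) 4 (2 * v)
      × (Σ[ σ ∈ Permutation′ (2 * v) ]
          (∀ i j → concurrence N (σ ⟨$⟩ʳ i) (σ ⟨$⟩ʳ j) ≡ circulant (2 * v) (firstRow v) i j))
      × (∀ (x : ℤ) → charPoly (2 * v) (circulant (2 * v) (firstRow v)) x
           ≡ (x ℤ.- + (4 * (v ∸ 1))) ℤ.* (x ℤ.- + (2 * v ∸ 4)) ℤ.^ (v ∸ 1) ℤ.* x ℤ.^ v)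
mainTheorem2 v@(suc v′) 3≤v =
  N , ((N-blockSize , N-replication) , N-NNᵀN)
    , (Permutation.id , λ i j → trans (N-concurrence i j) (sym (circulant-firstRow i j)))
    , charPoly-circulant v 3≤v
  where
  open DoubledCompleteGraph v′
  open CirculantPattern v′ using (circulant-firstRow)
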